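{- For every formula $\varphi$ of $\mathcal{L}_{RST}^{\{HF\}}$ with $\varphi\succ\emptyset$, $$RST_{HF}^m\vdash\left(\varphi[0/x]\wedge\forall x\,(\varphi\rightarrow\varphi[S(x)/x])\right)\rightarrow\forall x\in\widetilde{\mathbb{N}}.\,\varphi .$$
   Context: The language $\mathcal{L}_{RST}^{\{HF\}}$ is first-order with binary relations $\in,=$, one constant $HF$, connectives $\neg,\wedge,\vee$, the quantifier $\exists$ ($\forall$, $\to$ classical abbreviations), and set-abstraction terms. Terms, formulas and the safety relation $\varphi\succ\Theta$ ($\Theta$ a finite set of variables) are defined simultaneously: terms are the variables, $HF$, and $\{x\mid\varphi\}$ whenever $\varphi\succ\{x\}$; atomic formulas are $t=s$, $t\in s$; formulas are closed under $\neg,\wedge,\vee,\exists x$. Safety rules: every atomic formula is $\succ\emptyset$; if $x\notin Fv(t)$, each of $x\neq x$, $x\in t$, $x=t$, $t=x$ is $\succ\{x\}$; if $\varphi\succ\emptyset$ then $\neg\varphi\succ\emptyset$; if $\varphi\succ\Theta$ and $\psi\succ\Theta$ then $\varphi\vee\psi\succ\Theta$; if $\varphi\succ\Theta$, $\psi\succ\Phi$ and ($\Phi\cap Fv(\varphi)=\emptyset$ or $\Theta\cap Fv(\psi)=\emptyset$) then $\varphi\wedge\psi\succ\Theta\cup\Phi$; if $\varphi\succ\Theta$ and $y\in\Theta$ then $\exists y\varphi\succ\Theta\setminus\{y\}$. $RST_{HF}^m$ is the classical first-order theory (with variable-binding term operator) in this language with axioms: Extensionality; Comprehension $\forall x(x\in\{x\mid\varphi\}\leftrightarrow\varphi)$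 for every legal term $\{x\mid\varphi\}$; $\emptyset\in HF$; $\forall x\forall y(x\in HF\wedge y\in HF\to x\cup\{y\}\in HF)$; $\forall y(\emptyset\in y\wedge\forall v,w\in y.\,v\cup\{w\}\in y\to HF\subseteq y)$, with $\emptyset=\{x\mid x\neq x\}$, $\{y\}=\{x\mid x=y\}$, $a\cup b=\{x\mid x\in a\vee x\in b\}$. No $\in$-induction is assumed. Notation: $0:=\emptyset$, $S(x):=x\cup\{x\}$, $N(x):=\forall y\in x\cup\{x\}.\,(y=\emptyset\vee\exists w\in x.\,y=w\cup\{w\})$, $\widetilde{\mathbb{N}}:=\{x\mid x\in HF\wedge N(x)\}$; $\varphi[t/x]$ denotes substitution of $t$ for $x$. -}

module Defs where

open import Data.Nat using (ℕ; zero; suc; _⊔_; _≡ᵇ_)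
open import Data.Bool using (Bool; true; false; not; _∧_; _∨_; if_then_else_)
open import Data.List using (List; []; _∷_; _++_; foldr; [_])
open import Data.List.Membership.Propositional using (_∈_; _∉_)
open import Data.Product using (_×_)
open import Data.Sum using (_⊎_)
open import Data.Unit using (⊤)
open import Relation.Binary.PropositionalEquality using (_≡_)

mutual
  data Term : Set where
    var : ℕ → Term
    HF  : Term
    abs : ℕ → Formula → Term          -- { x | φ }

  data Formula : Set where
    _≐_  : Term → Term → Formula
    _∈ₛ_ : Term → Term → Formula
    ¬ₛ   : Formula → Formula
    _∧ₛ_ : Formula → Formula → Formula
    _∨ₛ_ : Formula → Formula → Formula
    ∃ₛ   : ℕ → Formula → Formula

infix 7 _≐_ _∈ₛ_
infixr 6 _∧ₛ_
infixr 5 _∨ₛ_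

remove : ℕ → List ℕ → List ℕ
remove y [] = []
remove y (v ∷ l) = if v ≡ᵇ y then remove y l else v ∷ remove y l

mutual
  fvT : Term → List ℕ
  fvT (var x) = [ x ]
  fvT HF = []
  fvT (abs x φ) = remove x (fvF φ)

  fvF : Formula → List ℕ
  fvF (t ≐ s) = fvT t ++ fvT s
  fvF (t ∈ₛ s) = fvT t ++ fvT s
  fvF (¬ₛ φ) = fvF φ
  fvF (φ ∧ₛ ψ) = fvF φ ++ fvF ψ
  fvF (φ ∨ₛ ψ) = fvF φ ++ fvF ψ
  fvF (∃ₛ x φ) = remove x (fvF φ)

fresh : List ℕ → ℕ
fresh l = suc (foldr _⊔_ 0 l)

-- Substitution φ[t/x] (replaces free occurrences of x; does not rename
-- binders, so it is only used together with `FreeFor` or where no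
-- capture can occur).

mutual
  subT : ℕ → Term → Term → Term
  subT x t (var y) = if y ≡ᵇ x then t else var y
  subT x t HF = HF
  subT x t (abs y φ) = if y ≡ᵇ x then abs y φ else abs y (subF x t φ)

  subF : ℕ → Term → Formula → Formula
  subF x t (a ≐ b) = subT x t a ≐ subT x t b
  subF x t (a ∈ₛ b) = subT x t a ∈ₛ subT x t b
  subF x t (¬ₛ φ) = ¬ₛ (subF x t φ)
  subF x t (φ ∧ₛ ψ) = subF x t φ ∧ₛ subF x t ψ
  subF x t (φ ∨ₛ ψ) = subF x t φ ∨ₛ subF x t ψ
  subF x t (∃ₛ y φ) = if y ≡ᵇ x then ∃ₛ y φ else ∃ₛ y (subF x t φ)

mutual
  FreeForT : ℕ → Term → Term → Set
  FreeForT x t (var y) = ⊤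
  FreeForT x t HF = ⊤
  FreeForT x t (abs y φ) = (x ∉ fvT (abs y φ)) ⊎ ((y ∉ fvT t) × FreeForF x t φ)

  FreeForF : ℕ → Term → Formula → Set
  FreeForF x t (a ≐ b) = FreeForT x t a × FreeForT x t b
  FreeForF x t (a ∈ₛ b) = FreeForT x t a × FreeForT x t b
  FreeForF x t (¬ₛ φ) = FreeForF x t φ
  FreeForF x t (φ ∧ₛ ψ) = FreeForF x t φ × FreeForF x t ψ
  FreeForF x t (φ ∨ₛ ψ) = FreeForF x t φ × FreeForF x t ψ
  FreeForF x t (∃ₛ y φ) = (x ∉ fvF (∃ₛ y φ)) ⊎ ((y ∉ fvT t) × FreeForF x t φ)

-- Legal terms/formulas and the safety relation φ ≻ Θ, defined
-- simultaneously.  Finite sets of variables are lists, taken up to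
-- having the same elements (rule `≻-set`).

SameSet : List ℕ → List ℕ → Set
SameSet Θ Φ = ∀ v → (v ∈ Θ → v ∈ Φ) × (v ∈ Φ → v ∈ Θ)

Disjoint : List ℕ → List ℕ → Set
Disjoint Θ Φ = ∀ v → v ∈ Θ → v ∉ Φ

infix 4 _≻_

mutual
  data WfT : Term → Set where
    wf-var : ∀ x → WfT (var x)
    wf-HF  : WfT HF
    wf-abs : ∀ {x φ} → φ ≻ [ x ] → WfT (abs x φ)

  data WfF : Formula → Set where
    wf-≐ : ∀ {t s} → WfT t → WfT s → WfF (t ≐ s)
    wf-∈ : ∀ {t s} → WfT t → WfT s → WfF (t ∈ₛ s)
    wf-¬ : ∀ {φ} → WfF φ → WfF (¬ₛ φ)
    wf-∧ : ∀ {φ ψ} → WfF φ → WfF ψ → WfF (φ ∧ₛ ψ)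
    wf-∨ : ∀ {φ ψ} → WfF φ → WfF ψ → WfF (φ ∨ₛ ψ)
    wf-∃ : ∀ {φ} x → WfF φ → WfF (∃ₛ x φ)

  data _≻_ : Formula → List ℕ → Set where
    ≻-≐   : ∀ {t s} → WfT t → WfT s → t ≐ s ≻ []
    ≻-∈   : ∀ {t s} → WfT t → WfT s → t ∈ₛ s ≻ []
    ≻-neq : ∀ x → ¬ₛ (var x ≐ var x) ≻ [ x ]
    ≻-x∈t : ∀ {x t} → WfT t → x ∉ fvT t → var x ∈ₛ t ≻ [ x ]
    ≻-x=t : ∀ {x t} → WfT t → x ∉ fvT t → var x ≐ t ≻ [ x ]
    ≻-t=x : ∀ {x t} → WfT t → x ∉ fvT t → t ≐ var x ≻ [ x ]
    ≻-¬   : ∀ {φ} → φ ≻ [] → ¬ₛ φ ≻ []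
    ≻-∨   : ∀ {φ ψ Θ} → φ ≻ Θ → ψ ≻ Θ → φ ∨ₛ ψ ≻ Θ
    ≻-∧   : ∀ {φ ψ Θ Φ} → φ ≻ Θ → ψ ≻ Φ →
            (Disjoint Φ (fvF φ) ⊎ Disjoint Θ (fvF ψ)) → φ ∧ₛ ψ ≻ Θ ++ Φ
    ≻-∃   : ∀ {φ Θ y} → φ ≻ Θ → y ∈ Θ → ∃ₛ y φ ≻ remove y Θ
    ≻-set : ∀ {φ Θ Φ} → φ ≻ Θ → SameSet Θ Φ → φ ≻ Φ

infixr 4 _⇒ₛ_
_⇒ₛ_ : Formula → Formula → Formula
φ ⇒ₛ ψ = ¬ₛ φ ∨ₛ ψ

infix 4 _⇔ₛ_
_⇔ₛ_ : Formula → Formula → Formula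
φ ⇔ₛ ψ = (φ ⇒ₛ ψ) ∧ₛ (ψ ⇒ₛ φ)

∀ₛ : ℕ → Formula → Formula
∀ₛ x φ = ¬ₛ (∃ₛ x (¬ₛ φ))

∀∈ : ℕ → Term → Formula → Formula
∀∈ y t φ = ¬ₛ (∃ₛ y (var y ∈ₛ t ∧ₛ ¬ₛ φ))

∃∈ : ℕ → Term → Formula → Formula
∃∈ y t φ = ∃ₛ y (var y ∈ₛ t ∧ₛ φ)

∅ₛ : Term
∅ₛ = abs 0 (¬ₛ (var 0 ≐ var 0))

sing : Term → Term
sing a = abs z (var z ≐ a) where z = fresh (fvT a)

_∪ₛ_ : Term → Term → Term
a ∪ₛ b = abs z (var z ∈ₛ a ∨ₛ var z ∈ₛ b) where z = fresh (fvT a ++ fvT b)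

zeroₛ : Term
zeroₛ = ∅ₛ

Sₛ : Term → Term
Sₛ a = a ∪ₛ sing a

Nₛ : Term → Formula
Nₛ a = ∀∈ y (Sₛ a) (var y ≐ ∅ₛ ∨ₛ ∃∈ w a (var y ≐ Sₛ (var w)))
  where
    y = fresh (fvT a)
    w = fresh (y ∷ fvT a)

Ñ : Term
Ñ = abs 0 (var 0 ∈ₛ HF ∧ₛ Nₛ (var 0))

-- Classical first-order logic with equality (Shoenfield-style Hilbert
-- system with ∃ primitive; all axiom instances are legal formulas).

eval : (Formula → Bool) → Formula → Bool
eval v (a ≐ b) = v (a ≐ b)
eval v (a ∈ₛ b) = v (a ∈ₛ b)
eval v (¬ₛ φ) = not (eval v φ)
eval v (φ ∧ₛ ψ) = eval v φ ∧ eval v ψ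
eval v (φ ∨ₛ ψ) = eval v φ ∨ eval v ψ
eval v (∃ₛ x φ) = v (∃ₛ x φ)

Tautology : Formula → Set
Tautology φ = ∀ (v : Formula → Bool) → eval v φ ≡ true

data RSTAxiom : Formula → Set where
  extensionality :
    RSTAxiom (∀ₛ 0 (∀ₛ 1 (∀ₛ 2 (var 2 ∈ₛ var 0 ⇔ₛ var 2 ∈ₛ var 1) ⇒ₛ var 0 ≐ var 1)))
  comprehension : ∀ x φ → WfT (abs x φ) →
    RSTAxiom (∀ₛ x (var x ∈ₛ abs x φ ⇔ₛ φ))
  hf-empty : RSTAxiom (∅ₛ ∈ₛ HF)
  hf-closed :
    RSTAxiom (∀ₛ 0 (∀ₛ 1 ((var 0 ∈ₛ HF ∧ₛ var 1 ∈ₛ HF) ⇒ₛ (var 0 ∪ₛ sing (var 1)) ∈ₛ HF)))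
  hf-least :
    RSTAxiom (∀ₛ 0 ((∅ₛ ∈ₛ var 0 ∧ₛ ∀∈ 1 (var 0) (∀∈ 2 (var 0) ((var 1 ∪ₛ sing (var 2)) ∈ₛ var 0)))
                    ⇒ₛ ∀ₛ 3 (var 3 ∈ₛ HF ⇒ₛ var 3 ∈ₛ var 0)))

infix 3 RST⊢_

data RST⊢_ : Formula → Set where
  taut    : ∀ {φ} → WfF φ → Tautology φ → RST⊢ φ
  ax      : ∀ {φ} → RSTAxiom φ → RST⊢ φ
  ∃-ax    : ∀ {φ t} x → WfF φ → WfT t → FreeForF x t φ → RST⊢ (subF x t φ ⇒ₛ ∃ₛ x φ)
  eq-refl : ∀ x → RST⊢ (var x ≐ var x)
  eq-subst : ∀ {φ s t} z → WfF φ → WfT s → WfT t → FreeForF z s φ → FreeForF z t φ →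
             RST⊢ (s ≐ t ⇒ₛ (subF z s φ ⇒ₛ subF z t φ))
  mp      : ∀ {φ ψ} → RST⊢ φ → RST⊢ (φ ⇒ₛ ψ) → RST⊢ ψ
  ∃-intro : ∀ {φ ψ} x → RST⊢ (φ ⇒ₛ ψ) → x ∉ fvF ψ → RST⊢ (∃ₛ x φ ⇒ₛ ψ)

-- Take C = {x | x ∈ HF ∧ φ}, a legal term since φ ≻ ∅: the hypotheses say that ∅ ∈ C
-- and that C is closed under S on HF, so it suffices to show Ñ ⊆ C for every such C.
-- With no ∈-induction available, call u tame if u ∈ HF, u ∉ u, no w satisfies
-- u ∈ w ∈ u, and N(u) implies u ∈ C; let D be the set of those v ∈ HF all of whose
-- elements are tame. Every v ∈ D is itself tame. The only nontrivial clause is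
-- N(v) → v ∈ C: if N(v) and v = S(w) with w ∈ v, then w is tame and satisfies N(w),
-- because an element y = S(u) of S(w) has u ∈ v = w ∪ {w}, and u = w would force
-- y = v, hence v ∈ w ∈ v or w ∈ w; so w ∈ C and v = S(w) ∈ C. Consequently D contains
-- ∅ and is closed under v, w ↦ v ∪ {w}, the minimality of HF gives HF ⊆ D, and every
-- x ∈ Ñ is tame with N(x), that is, x ∈ C.

module Submission where

open import Defs
open import Agda.Builtin.FromNat using (Number; fromNat)
import Data.Nat.Literals
open import Data.Nat using (ℕ; zero; suc; _+_; _⊔_; _≡ᵇ_; _≤_; _≤?_; s≤s)
open import Data.Nat.Properties using (≡ᵇ⇒≡; _≟_; m≤m⊔n; m≤n⇒m≤o⊔n; <⇒≢; ≤-trans; m≤n+m)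
open import Data.Bool using (Bool; true; false; not; _∧_; _∨_; T)
open import Data.Fin using (Fin; zero; suc; #_)
open import Data.List using (List; []; _∷_; _++_; foldr)
open import Data.List.Membership.Propositional using (_∈_; _∉_)
open import Data.List.Membership.DecPropositional _≟_ using (_∈?_)
open import Data.List.Membership.Propositional.Properties using (∈-++⁺ˡ; ∈-++⁺ʳ; ∈-++⁻)
open import Data.List.Relation.Unary.Any using (here; there)
open import Data.Maybe using (Maybe; just; nothing; is-just; _<∣>_; to-witness-T)
open import Data.Product using (_×_; _,_; proj₁; proj₂)
open import Data.Sum using (_⊎_; inj₁; inj₂; [_,_])
open import Data.Unit using (⊤; tt)
open import Data.Empty using (⊥; ⊥-elim)
open import Data.Vec using (Vec; []; _∷_; lookup; map)
open import Data.Vec.Properties using (lookup-map)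
open import Data.Vec.Relation.Unary.All using (All; []; _∷_)
open import Function using (_∘_)
open import Relation.Nullary using (yes; no)
open import Relation.Nullary.Decidable using (True)
open import Relation.Binary.PropositionalEquality using (_≡_; _≢_; refl; sym; trans; cong; cong₂; subst; subst₂)

-- With fromNat in scope every numeral is overloaded, ℕ included.
instance
  ℕ-number : Number ℕ
  ℕ-number = Data.Nat.Literals.number

-- Variables and substitution

≡ᵇ-refl : ∀ n → (n ≡ᵇ n) ≡ true
≡ᵇ-refl zero = refl
≡ᵇ-refl (suc n) = ≡ᵇ-refl n

≡ᵇ-true⇒≡ : ∀ {m n} → (m ≡ᵇ n) ≡ true → m ≡ n
≡ᵇ-true⇒≡ {m} {n} eq = ≡ᵇ⇒≡ m n (subst T (sym eq) tt)

≡ᵇ-false⇒≢ : ∀ {m n} → (m ≡ᵇ n) ≡ false → m ≢ n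
≡ᵇ-false⇒≢ {m} eq refl with () ← trans (sym (≡ᵇ-refl m)) eq

≢⇒≡ᵇ-false : ∀ {m n} → m ≢ n → (m ≡ᵇ n) ≡ false
≢⇒≡ᵇ-false {m} {n} m≢n with m ≡ᵇ n in eq
... | true = ⊥-elim (m≢n (≡ᵇ-true⇒≡ eq))
... | false = refl

∈-remove⁻ : ∀ {v y} l → v ∈ remove y l → v ∈ l × v ≢ y
∈-remove⁻ {y = y} (w ∷ l) p with w ≡ᵇ y in eq
... | true = let (v∈l , v≢y) = ∈-remove⁻ l p in there v∈l , v≢y
... | false with p
...   | here refl = here refl , ≡ᵇ-false⇒≢ eq
...   | there q = let (v∈l , v≢y) = ∈-remove⁻ l q in there v∈l , v≢y

∈-remove⁺ : ∀ {v y l} → v ∈ l → v ≢ y → v ∈ remove y l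
∈-remove⁺ {l = w ∷ l} (here refl) v≢y rewrite ≢⇒≡ᵇ-false v≢y = here refl
∈-remove⁺ {y = y} {l = w ∷ l} (there p) v≢y with w ≡ᵇ y
... | true = ∈-remove⁺ p v≢y
... | false = there (∈-remove⁺ p v≢y)

∉-remove : ∀ {y} l → y ∉ remove y l
∉-remove l p = proj₂ (∈-remove⁻ l p) refl

remove-[x] : ∀ y → remove y (y ∷ []) ≡ []
remove-[x] y rewrite ≡ᵇ-refl y = refl

∉-++ : ∀ {v : ℕ} {l m} → v ∉ l → v ∉ m → v ∉ l ++ m
∉-++ {l = l} v∉l v∉m p = [ v∉l , v∉m ] (∈-++⁻ l p)

∉-++ˡ : ∀ {v : ℕ} l {m} → v ∉ l ++ m → v ∉ l
∉-++ˡ l v∉ p = v∉ (∈-++⁺ˡ p)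

∉-++ʳ : ∀ {v : ℕ} l {m} → v ∉ l ++ m → v ∉ m
∉-++ʳ l v∉ p = v∉ (∈-++⁺ʳ l p)

∈-++-mono : ∀ {v : ℕ} {l₁ l₂ m₁ m₂ n} → (v ∈ l₁ → v ∈ m₁ ⊎ v ∈ n) → (v ∈ l₂ → v ∈ m₂ ⊎ v ∈ n) →
            v ∈ l₁ ++ l₂ → v ∈ m₁ ++ m₂ ⊎ v ∈ n
∈-++-mono {l₁ = l₁} {m₁ = m₁} f g p with ∈-++⁻ l₁ p
... | inj₁ q = [ inj₁ ∘ ∈-++⁺ˡ , inj₂ ] (f q)
... | inj₂ q = [ inj₁ ∘ ∈-++⁺ʳ m₁ , inj₂ ] (g q)

∈-remove-mono : ∀ y {v : ℕ} {l m n} → (v ∈ l → v ∈ m ⊎ v ∈ n) → v ∈ remove y l → v ∈ remove y m ⊎ v ∈ n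
∈-remove-mono y {l = l} f p with ∈-remove⁻ l p
... | v∈l , v≢y = [ (λ q → inj₁ (∈-remove⁺ q v≢y)) , inj₂ ] (f v∈l)

≤-foldr-⊔ : ∀ {v l} → v ∈ l → v ≤ foldr _⊔_ 0 l
≤-foldr-⊔ {v} (here refl) = m≤m⊔n v _
≤-foldr-⊔ {l = w ∷ l} (there p) = m≤n⇒m≤o⊔n w (≤-foldr-⊔ p)

fresh-∉ : ∀ l → fresh l ∉ l
fresh-∉ l p = <⇒≢ (≤-foldr-⊔ p) refl

mutual
  ∈-fvT-subT : ∀ x t s {v} → v ∈ fvT (subT x t s) → v ∈ fvT s ⊎ v ∈ fvT t
  ∈-fvT-subT x t (var y) p with y ≡ᵇ x
  ... | true = inj₂ p
  ... | false = inj₁ p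
  ∈-fvT-subT x t (abs y φ) p with y ≡ᵇ x
  ... | true = inj₁ p
  ... | false = ∈-remove-mono y (∈-fvF-subF x t φ) p

  ∈-fvF-subF : ∀ x t φ {v} → v ∈ fvF (subF x t φ) → v ∈ fvF φ ⊎ v ∈ fvT t
  ∈-fvF-subF x t (a ≐ b) = ∈-++-mono (∈-fvT-subT x t a) (∈-fvT-subT x t b)
  ∈-fvF-subF x t (a ∈ₛ b) = ∈-++-mono (∈-fvT-subT x t a) (∈-fvT-subT x t b)
  ∈-fvF-subF x t (¬ₛ φ) = ∈-fvF-subF x t φ
  ∈-fvF-subF x t (φ ∧ₛ ψ) = ∈-++-mono (∈-fvF-subF x t φ) (∈-fvF-subF x t ψ)
  ∈-fvF-subF x t (φ ∨ₛ ψ) = ∈-++-mono (∈-fvF-subF x t φ) (∈-fvF-subF x t ψ)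
  ∈-fvF-subF x t (∃ₛ y φ) p with y ≡ᵇ x
  ... | true = inj₁ p
  ... | false = ∈-remove-mono y (∈-fvF-subF x t φ) p

∉-fvT-subT : ∀ {z} x t s → z ∉ fvT s → z ∉ fvT t → z ∉ fvT (subT x t s)
∉-fvT-subT x t s z∉s z∉t p = [ z∉s , z∉t ] (∈-fvT-subT x t s p)

∉-fvF-subF : ∀ {z} x t φ → z ∉ fvF φ → z ∉ fvT t → z ∉ fvF (subF x t φ)
∉-fvF-subF x t φ z∉φ z∉t p = [ z∉φ , z∉t ] (∈-fvF-subF x t φ p)

mutual
  subT-notFree : ∀ x t s → x ∉ fvT s → subT x t s ≡ s
  subT-notFree x t (var y) x∉ rewrite ≢⇒≡ᵇ-false {y} {x} (λ e → x∉ (here (sym e))) = refl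
  subT-notFree x t HF x∉ = refl
  subT-notFree x t (abs y φ) x∉ with y ≡ᵇ x in eq
  ... | true = refl
  ... | false = cong (abs y) (subF-notFree x t φ (λ p → x∉ (∈-remove⁺ p (≡ᵇ-false⇒≢ eq ∘ sym))))

  subF-notFree : ∀ x t φ → x ∉ fvF φ → subF x t φ ≡ φ
  subF-notFree x t (a ≐ b) x∉ = cong₂ _≐_ (subT-notFree x t a (∉-++ˡ (fvT a) x∉)) (subT-notFree x t b (∉-++ʳ (fvT a) x∉))
  subF-notFree x t (a ∈ₛ b) x∉ = cong₂ _∈ₛ_ (subT-notFree x t a (∉-++ˡ (fvT a) x∉)) (subT-notFree x t b (∉-++ʳ (fvT a) x∉))
  subF-notFree x t (¬ₛ φ) x∉ = cong ¬ₛ (subF-notFree x t φ x∉)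
  subF-notFree x t (φ ∧ₛ ψ) x∉ = cong₂ _∧ₛ_ (subF-notFree x t φ (∉-++ˡ (fvF φ) x∉)) (subF-notFree x t ψ (∉-++ʳ (fvF φ) x∉))
  subF-notFree x t (φ ∨ₛ ψ) x∉ = cong₂ _∨ₛ_ (subF-notFree x t φ (∉-++ˡ (fvF φ) x∉)) (subF-notFree x t ψ (∉-++ʳ (fvF φ) x∉))
  subF-notFree x t (∃ₛ y φ) x∉ with y ≡ᵇ x in eq
  ... | true = refl
  ... | false = cong (∃ₛ y) (subF-notFree x t φ (λ p → x∉ (∈-remove⁺ p (≡ᵇ-false⇒≢ eq ∘ sym))))

subT-var-self : ∀ x t → subT x t (var x) ≡ t
subT-var-self x t rewrite ≡ᵇ-refl x = refl

mutual
  subT-wf : ∀ {x t} s → WfT t → FreeForT x t s → WfT s → WfT (subT x t s)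
  subT-wf {x} (var y) wt _ ws with y ≡ᵇ x
  ... | true = wt
  ... | false = ws
  subT-wf HF _ _ ws = ws
  subT-wf {x} {t} (abs y φ) wt ff (wf-abs φ≻y) with y ≡ᵇ x in eq
  ... | true = wf-abs φ≻y
  ... | false with ff
  ...   | inj₁ x∉ = subst WfT (sym (cong (abs y) (subF-notFree x t φ (λ p → x∉ (∈-remove⁺ p (≡ᵇ-false⇒≢ eq ∘ sym))))))
                      (wf-abs φ≻y)
  ...   | inj₂ (y∉t , ff′) = wf-abs (subF-safe wt ff′ (λ { (here e) → ≡ᵇ-false⇒≢ eq (sym e) })
                                                     (λ { _ (here refl) → y∉t }) φ≻y)

  subF-wf : ∀ {x t} φ → WfT t → FreeForF x t φ → WfF φ → WfF (subF x t φ)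
  subF-wf (a ≐ b) wt (ffa , ffb) (wf-≐ wa wb) = wf-≐ (subT-wf a wt ffa wa) (subT-wf b wt ffb wb)
  subF-wf (a ∈ₛ b) wt (ffa , ffb) (wf-∈ wa wb) = wf-∈ (subT-wf a wt ffa wa) (subT-wf b wt ffb wb)
  subF-wf (¬ₛ φ) wt ff (wf-¬ w) = wf-¬ (subF-wf φ wt ff w)
  subF-wf (φ ∧ₛ ψ) wt (ffφ , ffψ) (wf-∧ wφ wψ) = wf-∧ (subF-wf φ wt ffφ wφ) (subF-wf ψ wt ffψ wψ)
  subF-wf (φ ∨ₛ ψ) wt (ffφ , ffψ) (wf-∨ wφ wψ) = wf-∨ (subF-wf φ wt ffφ wφ) (subF-wf ψ wt ffψ wψ)
  subF-wf {x} {t} (∃ₛ y φ) wt ff (wf-∃ .y w) with y ≡ᵇ x in eq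
  ... | true = wf-∃ y w
  ... | false with ff
  ...   | inj₁ x∉ = subst WfF (sym (cong (∃ₛ y) (subF-notFree x t φ (λ p → x∉ (∈-remove⁺ p (≡ᵇ-false⇒≢ eq ∘ sym))))))
                      (wf-∃ y w)
  ...   | inj₂ (_ , ff′) = wf-∃ y (subF-wf φ wt ff′ w)

  -- The substituted variable is not one of the safe variables, and the term
  -- mentions none of them, so every side condition of the safety rules survives.
  subF-safe : ∀ {x t φ Θ} → WfT t → FreeForF x t φ → x ∉ Θ → Disjoint Θ (fvT t) → φ ≻ Θ → subF x t φ ≻ Θ
  subF-safe wt (ffa , ffb) _ _ (≻-≐ {a} {b} wa wb) = ≻-≐ (subT-wf a wt ffa wa) (subT-wf b wt ffb wb)
  subF-safe wt (ffa , ffb) _ _ (≻-∈ {a} {b} wa wb) = ≻-∈ (subT-wf a wt ffa wa) (subT-wf b wt ffb wb)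
  subF-safe {x} _ _ x∉ _ (≻-neq z) rewrite ≢⇒≡ᵇ-false {z} {x} (λ e → x∉ (here (sym e))) = ≻-neq z
  subF-safe {x} {t} wt (_ , ffs) x∉ dj (≻-x∈t {z} {s} ws z∉s)
    rewrite ≢⇒≡ᵇ-false {z} {x} (λ e → x∉ (here (sym e))) =
    ≻-x∈t (subT-wf s wt ffs ws) (∉-fvT-subT x t s z∉s (dj z (here refl)))
  subF-safe {x} {t} wt (_ , ffs) x∉ dj (≻-x=t {z} {s} ws z∉s)
    rewrite ≢⇒≡ᵇ-false {z} {x} (λ e → x∉ (here (sym e))) =
    ≻-x=t (subT-wf s wt ffs ws) (∉-fvT-subT x t s z∉s (dj z (here refl)))
  subF-safe {x} {t} wt (ffs , _) x∉ dj (≻-t=x {z} {s} ws z∉s)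
    rewrite ≢⇒≡ᵇ-false {z} {x} (λ e → x∉ (here (sym e))) =
    ≻-t=x (subT-wf s wt ffs ws) (∉-fvT-subT x t s z∉s (dj z (here refl)))
  subF-safe wt ff x∉ dj (≻-¬ d) = ≻-¬ (subF-safe wt ff x∉ dj d)
  subF-safe wt (ffφ , ffψ) x∉ dj (≻-∨ d e) = ≻-∨ (subF-safe wt ffφ x∉ dj d) (subF-safe wt ffψ x∉ dj e)
  subF-safe {x} {t} wt (ffφ , ffψ) x∉ dj (≻-∧ {φ} {ψ} {Θ} {Φ} d e side) =
    ≻-∧ (subF-safe wt ffφ (∉-++ˡ Θ x∉) (λ v p → dj v (∈-++⁺ˡ p)) d)
        (subF-safe wt ffψ (∉-++ʳ Θ x∉) (λ v p → dj v (∈-++⁺ʳ Θ p)) e)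
        ([ (λ k → inj₁ λ v p → ∉-fvF-subF x t φ (k v p) (dj v (∈-++⁺ʳ Θ p)))
         , (λ k → inj₂ λ v p → ∉-fvF-subF x t ψ (k v p) (dj v (∈-++⁺ˡ p))) ] side)
  subF-safe {x} {t} wt ff x∉ dj (≻-∃ {φ} {Θ} {y} d y∈Θ) with y ≡ᵇ x in eq
  ... | true = ≻-∃ d y∈Θ
  ... | false with ff
  ...   | inj₁ x∉∃ = subst (λ ψ → ∃ₛ y ψ ≻ remove y Θ)
                        (sym (subF-notFree x t φ (λ p → x∉∃ (∈-remove⁺ p (≡ᵇ-false⇒≢ eq ∘ sym)))))
                        (≻-∃ d y∈Θ)
  ...   | inj₂ (y∉t , ff′) = ≻-∃ (subF-safe wt ff′ (λ p → x∉ (∈-remove⁺ p (≡ᵇ-false⇒≢ eq ∘ sym))) dj′ d) y∈Θ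
    where
    dj′ : Disjoint Θ (fvT t)
    dj′ v p with v ≟ y
    ... | yes refl = y∉t
    ... | no v≢y = dj v (∈-remove⁺ p v≢y)
  subF-safe wt ff x∉ dj (≻-set d same) =
    ≻-set (subF-safe wt ff (x∉ ∘ proj₁ (same _)) (λ v → dj v ∘ proj₁ (same v)) d) same

safe⇒wf : ∀ {φ Θ} → φ ≻ Θ → WfF φ
safe⇒wf (≻-≐ wa wb) = wf-≐ wa wb
safe⇒wf (≻-∈ wa wb) = wf-∈ wa wb
safe⇒wf (≻-neq x) = wf-¬ (wf-≐ (wf-var x) (wf-var x))
safe⇒wf (≻-x∈t {x} w _) = wf-∈ (wf-var x) w
safe⇒wf (≻-x=t {x} w _) = wf-≐ (wf-var x) w
safe⇒wf (≻-t=x {x} w _) = wf-≐ w (wf-var x)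
safe⇒wf (≻-¬ d) = wf-¬ (safe⇒wf d)
safe⇒wf (≻-∨ d e) = wf-∨ (safe⇒wf d) (safe⇒wf e)
safe⇒wf (≻-∧ d e _) = wf-∧ (safe⇒wf d) (safe⇒wf e)
safe⇒wf (≻-∃ {y = y} d _) = wf-∃ y (safe⇒wf d)
safe⇒wf (≻-set d _) = safe⇒wf d

mutual
  bvT : Term → List ℕ
  bvT (var _) = []
  bvT HF = []
  bvT (abs y φ) = y ∷ bvF φ

  bvF : Formula → List ℕ
  bvF (a ≐ b) = bvT a ++ bvT b
  bvF (a ∈ₛ b) = bvT a ++ bvT b
  bvF (¬ₛ φ) = bvF φ
  bvF (φ ∧ₛ ψ) = bvF φ ++ bvF ψ
  bvF (φ ∨ₛ ψ) = bvF φ ++ bvF ψ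
  bvF (∃ₛ y φ) = y ∷ bvF φ

freeForT-notFree : ∀ {x t} s → x ∉ fvT s → FreeForT x t s
freeForT-notFree (var _) _ = tt
freeForT-notFree HF _ = tt
freeForT-notFree (abs _ _) x∉ = inj₁ x∉

mutual
  freeForT-bv : ∀ x t s → Disjoint (fvT t) (bvT s) → FreeForT x t s
  freeForT-bv x t (var _) _ = tt
  freeForT-bv x t HF _ = tt
  freeForT-bv x t (abs y φ) dj with x ∈? fvT (abs y φ)
  ... | no x∉ = inj₁ x∉
  ... | yes _ = inj₂ ((λ p → dj y p (here refl)) , freeForF-bv x t φ (λ w p q → dj w p (there q)))

  freeForF-bv : ∀ x t φ → Disjoint (fvT t) (bvF φ) → FreeForF x t φ
  freeForF-bv x t (a ≐ b) dj = freeForT-bv x t a (λ w p → ∉-++ˡ (bvT a) (dj w p)) , freeForT-bv x t b (λ w p → ∉-++ʳ (bvT a) (dj w p))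
  freeForF-bv x t (a ∈ₛ b) dj = freeForT-bv x t a (λ w p → ∉-++ˡ (bvT a) (dj w p)) , freeForT-bv x t b (λ w p → ∉-++ʳ (bvT a) (dj w p))
  freeForF-bv x t (¬ₛ φ) dj = freeForF-bv x t φ dj
  freeForF-bv x t (φ ∧ₛ ψ) dj = freeForF-bv x t φ (λ w p → ∉-++ˡ (bvF φ) (dj w p)) , freeForF-bv x t ψ (λ w p → ∉-++ʳ (bvF φ) (dj w p))
  freeForF-bv x t (φ ∨ₛ ψ) dj = freeForF-bv x t φ (λ w p → ∉-++ˡ (bvF φ) (dj w p)) , freeForF-bv x t ψ (λ w p → ∉-++ʳ (bvF φ) (dj w p))
  freeForF-bv x t (∃ₛ y φ) dj with x ∈? fvF (∃ₛ y φ)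
  ... | no x∉ = inj₁ x∉
  ... | yes _ = inj₂ ((λ p → dj y p (here refl)) , freeForF-bv x t φ (λ w p q → dj w p (there q)))

-- Binders equal to x block the substitution, and all other binders differ from
-- the only free variable of t.
mutual
  freeForT-fv⊆x : ∀ x t s → (∀ w → w ∈ fvT t → w ≡ x) → FreeForT x t s
  freeForT-fv⊆x x t (var _) _ = tt
  freeForT-fv⊆x x t HF _ = tt
  freeForT-fv⊆x x t (abs z φ) fv⊆x with z ≟ x
  ... | yes refl = inj₁ (∉-remove (fvF φ))
  ... | no z≢x = inj₂ (z≢x ∘ fv⊆x z , freeForF-fv⊆x x t φ fv⊆x)

  freeForF-fv⊆x : ∀ x t φ → (∀ w → w ∈ fvT t → w ≡ x) → FreeForF x t φ
  freeForF-fv⊆x x t (a ≐ b) h = freeForT-fv⊆x x t a h , freeForT-fv⊆x x t b h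
  freeForF-fv⊆x x t (a ∈ₛ b) h = freeForT-fv⊆x x t a h , freeForT-fv⊆x x t b h
  freeForF-fv⊆x x t (¬ₛ φ) h = freeForF-fv⊆x x t φ h
  freeForF-fv⊆x x t (φ ∧ₛ ψ) h = freeForF-fv⊆x x t φ h , freeForF-fv⊆x x t ψ h
  freeForF-fv⊆x x t (φ ∨ₛ ψ) h = freeForF-fv⊆x x t φ h , freeForF-fv⊆x x t ψ h
  freeForF-fv⊆x x t (∃ₛ z φ) fv⊆x with z ≟ x
  ... | yes refl = inj₁ (∉-remove (fvF φ))
  ... | no z≢x = inj₂ (z≢x ∘ fv⊆x z , freeForF-fv⊆x x t φ fv⊆x)

mutual
  ∈-bvT-subT : ∀ x t s {v} → v ∈ bvT (subT x t s) → v ∈ bvT s ⊎ v ∈ bvT t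
  ∈-bvT-subT x t (var y) p with y ≡ᵇ x
  ... | true = inj₂ p
  ... | false = inj₁ p
  ∈-bvT-subT x t (abs y φ) p with y ≡ᵇ x
  ... | true = inj₁ p
  ... | false = ∈-bv-under-binder (∈-bvF-subF x t φ) p

  ∈-bvF-subF : ∀ x t φ {v} → v ∈ bvF (subF x t φ) → v ∈ bvF φ ⊎ v ∈ bvT t
  ∈-bvF-subF x t (a ≐ b) = ∈-++-mono (∈-bvT-subT x t a) (∈-bvT-subT x t b)
  ∈-bvF-subF x t (a ∈ₛ b) = ∈-++-mono (∈-bvT-subT x t a) (∈-bvT-subT x t b)
  ∈-bvF-subF x t (¬ₛ φ) = ∈-bvF-subF x t φ
  ∈-bvF-subF x t (φ ∧ₛ ψ) = ∈-++-mono (∈-bvF-subF x t φ) (∈-bvF-subF x t ψ)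
  ∈-bvF-subF x t (φ ∨ₛ ψ) = ∈-++-mono (∈-bvF-subF x t φ) (∈-bvF-subF x t ψ)
  ∈-bvF-subF x t (∃ₛ y φ) p with y ≡ᵇ x
  ... | true = inj₁ p
  ... | false = ∈-bv-under-binder (∈-bvF-subF x t φ) p

  ∈-bv-under-binder : ∀ {y v : ℕ} {l m n} → (v ∈ l → v ∈ m ⊎ v ∈ n) → v ∈ y ∷ l → v ∈ y ∷ m ⊎ v ∈ n
  ∈-bv-under-binder f (here e) = inj₁ (here e)
  ∈-bv-under-binder f (there p) = [ inj₁ ∘ there , inj₂ ] (f p)

mutual
  subT-subT : ∀ x s t u → subT x s (subT x t u) ≡ subT x (subT x s t) u
  subT-subT x s t (var y) with y ≡ᵇ x in eq
  ... | true = refl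
  ... | false rewrite eq = refl
  subT-subT x s t HF = refl
  subT-subT x s t (abs y φ) with y ≡ᵇ x in eq
  ... | true rewrite eq = refl
  ... | false rewrite eq = cong (abs y) (subF-subF x s t φ)

  subF-subF : ∀ x s t φ → subF x s (subF x t φ) ≡ subF x (subT x s t) φ
  subF-subF x s t (a ≐ b) = cong₂ _≐_ (subT-subT x s t a) (subT-subT x s t b)
  subF-subF x s t (a ∈ₛ b) = cong₂ _∈ₛ_ (subT-subT x s t a) (subT-subT x s t b)
  subF-subF x s t (¬ₛ φ) = cong ¬ₛ (subF-subF x s t φ)
  subF-subF x s t (φ ∧ₛ ψ) = cong₂ _∧ₛ_ (subF-subF x s t φ) (subF-subF x s t ψ)
  subF-subF x s t (φ ∨ₛ ψ) = cong₂ _∨ₛ_ (subF-subF x s t φ) (subF-subF x s t ψ)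
  subF-subF x s t (∃ₛ y φ) with y ≡ᵇ x in eq
  ... | true rewrite eq = refl
  ... | false rewrite eq = cong (∃ₛ y) (subF-subF x s t φ)

mutual
  subT-self : ∀ x u → subT x (var x) u ≡ u
  subT-self x (var y) with y ≡ᵇ x in eq
  ... | true = cong var (sym (≡ᵇ-true⇒≡ eq))
  ... | false = refl
  subT-self x HF = refl
  subT-self x (abs y φ) with y ≡ᵇ x
  ... | true = refl
  ... | false = cong (abs y) (subF-self x φ)

  subF-self : ∀ x φ → subF x (var x) φ ≡ φ
  subF-self x (a ≐ b) = cong₂ _≐_ (subT-self x a) (subT-self x b)
  subF-self x (a ∈ₛ b) = cong₂ _∈ₛ_ (subT-self x a) (subT-self x b)
  subF-self x (¬ₛ φ) = cong ¬ₛ (subF-self x φ)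
  subF-self x (φ ∧ₛ ψ) = cong₂ _∧ₛ_ (subF-self x φ) (subF-self x ψ)
  subF-self x (φ ∨ₛ ψ) = cong₂ _∨ₛ_ (subF-self x φ) (subF-self x ψ)
  subF-self x (∃ₛ y φ) with y ≡ᵇ x
  ... | true = refl
  ... | false = cong (∃ₛ y) (subF-self x φ)

-- Checking side conditions by evaluation

mutual
  wfT? : (t : Term) → Maybe (WfT t)
  wfT? (var x) = just (wf-var x)
  wfT? HF = just wf-HF
  wfT? (abs z φ) with safe[ z ]? φ
  ... | just d = just (wf-abs d)
  ... | nothing = nothing

  wfF? : (φ : Formula) → Maybe (WfF φ)
  wfF? (a ≐ b) with wfT? a | wfT? b
  ... | just wa | just wb = just (wf-≐ wa wb)
  ... | _ | _ = nothing
  wfF? (a ∈ₛ b) with wfT? a | wfT? b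
  ... | just wa | just wb = just (wf-∈ wa wb)
  ... | _ | _ = nothing
  wfF? (¬ₛ φ) with wfF? φ
  ... | just w = just (wf-¬ w)
  ... | nothing = nothing
  wfF? (φ ∧ₛ ψ) with wfF? φ | wfF? ψ
  ... | just wφ | just wψ = just (wf-∧ wφ wψ)
  ... | _ | _ = nothing
  wfF? (φ ∨ₛ ψ) with wfF? φ | wfF? ψ
  ... | just wφ | just wψ = just (wf-∨ wφ wψ)
  ... | _ | _ = nothing
  wfF? (∃ₛ x φ) with wfF? φ
  ... | just w = just (wf-∃ x w)
  ... | nothing = nothing

  safe[]? : (φ : Formula) → Maybe (φ ≻ [])
  safe[]? (a ≐ b) with wfT? a | wfT? b
  ... | just wa | just wb = just (≻-≐ wa wb)
  ... | _ | _ = nothing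
  safe[]? (a ∈ₛ b) with wfT? a | wfT? b
  ... | just wa | just wb = just (≻-∈ wa wb)
  ... | _ | _ = nothing
  safe[]? (¬ₛ φ) with safe[]? φ
  ... | just d = just (≻-¬ d)
  ... | nothing = nothing
  safe[]? (φ ∧ₛ ψ) with safe[]? φ | safe[]? ψ
  ... | just d | just e = just (≻-∧ d e (inj₁ λ _ ()))
  ... | _ | _ = nothing
  safe[]? (φ ∨ₛ ψ) with safe[]? φ | safe[]? ψ
  ... | just d | just e = just (≻-∨ d e)
  ... | _ | _ = nothing
  safe[]? (∃ₛ y φ) with safe[ y ]? φ
  ... | just d = just (subst (∃ₛ y φ ≻_) (remove-[x] y) (≻-∃ d (here refl)))
  ... | nothing = nothing

  -- Only the shapes of safety derivations that occur in this development are searched for.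
  safe[_]? : (z : ℕ) (φ : Formula) → Maybe (φ ≻ z ∷ [])
  safe[ z ]? (¬ₛ (var a ≐ var b)) with a ≟ z | b ≟ z
  ... | yes refl | yes refl = just (≻-neq z)
  ... | _ | _ = nothing
  safe[ z ]? (var a ∈ₛ s) with a ≟ z | z ∈? fvT s | wfT? s
  ... | yes refl | no z∉s | just ws = just (≻-x∈t ws z∉s)
  ... | _ | _ | _ = nothing
  safe[ z ]? (a ≐ b) = safe-x=t? z a b <∣> safe-t=x? z a b
  safe[ z ]? (φ ∨ₛ ψ) with safe[ z ]? φ | safe[ z ]? ψ
  ... | just d | just e = just (≻-∨ d e)
  ... | _ | _ = nothing
  safe[ z ]? (φ ∧ₛ ψ) with safe[ z ]? φ | safe[]? ψ | safe[]? φ | safe[ z ]? ψ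
  ... | just d | just e | _ | _ = just (≻-∧ d e (inj₁ λ _ ()))
  ... | _ | _ | just d | just e = just (≻-∧ d e (inj₂ λ _ ()))
  ... | _ | _ | _ | _ = nothing
  safe[ z ]? _ = nothing

  safe-x=t? : (z : ℕ) (a b : Term) → Maybe (a ≐ b ≻ z ∷ [])
  safe-x=t? z (var a) s with a ≟ z | z ∈? fvT s | wfT? s
  ... | yes refl | no z∉s | just ws = just (≻-x=t ws z∉s)
  ... | _ | _ | _ = nothing
  safe-x=t? z _ _ = nothing

  safe-t=x? : (z : ℕ) (a b : Term) → Maybe (a ≐ b ≻ z ∷ [])
  safe-t=x? z s (var a) with a ≟ z | z ∈? fvT s | wfT? s
  ... | yes refl | no z∉s | just ws = just (≻-t=x ws z∉s)
  ... | _ | _ | _ = nothing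
  safe-t=x? z _ _ = nothing

mutual
  freeForT? : ∀ x t s → Maybe (FreeForT x t s)
  freeForT? x t (var y) = just tt
  freeForT? x t HF = just tt
  freeForT? x t (abs y φ) with x ∈? fvT (abs y φ)
  ... | no x∉ = just (inj₁ x∉)
  ... | yes _ with y ∈? fvT t | freeForF? x t φ
  ...   | no y∉t | just ff = just (inj₂ (y∉t , ff))
  ...   | _ | _ = nothing

  freeForF? : ∀ x t φ → Maybe (FreeForF x t φ)
  freeForF? x t (a ≐ b) with freeForT? x t a | freeForT? x t b
  ... | just ffa | just ffb = just (ffa , ffb)
  ... | _ | _ = nothing
  freeForF? x t (a ∈ₛ b) with freeForT? x t a | freeForT? x t b
  ... | just ffa | just ffb = just (ffa , ffb)
  ... | _ | _ = nothing
  freeForF? x t (¬ₛ φ) = freeForF? x t φ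
  freeForF? x t (φ ∧ₛ ψ) with freeForF? x t φ | freeForF? x t ψ
  ... | just ffφ | just ffψ = just (ffφ , ffψ)
  ... | _ | _ = nothing
  freeForF? x t (φ ∨ₛ ψ) with freeForF? x t φ | freeForF? x t ψ
  ... | just ffφ | just ffψ = just (ffφ , ffψ)
  ... | _ | _ = nothing
  freeForF? x t (∃ₛ y φ) with x ∈? fvF (∃ₛ y φ)
  ... | no x∉ = just (inj₁ x∉)
  ... | yes _ with y ∈? fvT t | freeForF? x t φ
  ...   | no y∉t | just ff = just (inj₂ (y∉t , ff))
  ...   | _ | _ = nothing

∉? : (x : ℕ) (l : List ℕ) → Maybe (x ∉ l)
∉? x l with x ∈? l
... | yes _ = nothing
... | no x∉ = just x∉

-- The implicit proof is tt exactly when the checker succeeds, so on concrete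
-- syntax Agda discharges it by evaluation.
Succeeds : ∀ {A : Set} → Maybe A → Set
Succeeds m = T (is-just m)

wfT! : ∀ {t} {ok : Succeeds (wfT? t)} → WfT t
wfT! {t} {ok} = to-witness-T (wfT? t) ok

wfF! : ∀ {φ} {ok : Succeeds (wfF? φ)} → WfF φ
wfF! {φ} {ok} = to-witness-T (wfF? φ) ok

freeForF! : ∀ {x t φ} {ok : Succeeds (freeForF? x t φ)} → FreeForF x t φ
freeForF! {x} {t} {φ} {ok} = to-witness-T (freeForF? x t φ) ok

∉! : ∀ {x l} {ok : Succeeds (∉? x l)} → x ∉ l
∉! {x} {l} {ok} = to-witness-T (∉? x l) ok

-- Propositional reasoning by truth tables

infixr 4 _⟹_ _⟺_
infixr 6 _&_
infixr 5 _∣∣_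
infix 7 ~_

data PropForm (n : ℕ) : Set where
  atom : Fin n → PropForm n
  ~_   : PropForm n → PropForm n
  _&_  : PropForm n → PropForm n → PropForm n
  _∣∣_ : PropForm n → PropForm n → PropForm n
  _⟹_ : PropForm n → PropForm n → PropForm n

_⟺_ : ∀ {n} → PropForm n → PropForm n → PropForm n
p ⟺ q = (p ⟹ q) & (q ⟹ p)

-- The numeral k denotes the k-th atom, i.e. the k-th formula of the instantiating vector.
instance
  PropForm-number : ∀ {n} → Number (PropForm n)
  PropForm-number {n} = record
    { Constraint = λ m → True (suc m ≤? n)
    ; fromNat = λ m {{m<n}} → atom ((# m) {n} {m<n})
    }

instantiate : ∀ {n} → Vec Formula n → PropForm n → Formula
instantiate σ (atom i) = lookup σ i
instantiate σ (~ p) = ¬ₛ (instantiate σ p)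
instantiate σ (p & q) = instantiate σ p ∧ₛ instantiate σ q
instantiate σ (p ∣∣ q) = instantiate σ p ∨ₛ instantiate σ q
instantiate σ (p ⟹ q) = instantiate σ p ⇒ₛ instantiate σ q

evalProp : ∀ {n} → Vec Bool n → PropForm n → Bool
evalProp ρ (atom i) = lookup ρ i
evalProp ρ (~ p) = not (evalProp ρ p)
evalProp ρ (p & q) = evalProp ρ p ∧ evalProp ρ q
evalProp ρ (p ∣∣ q) = evalProp ρ p ∨ evalProp ρ q
evalProp ρ (p ⟹ q) = not (evalProp ρ p) ∨ evalProp ρ q

eval-instantiate : ∀ {n} v (σ : Vec Formula n) p → eval v (instantiate σ p) ≡ evalProp (map (eval v) σ) p
eval-instantiate v σ (atom i) = sym (lookup-map i (eval v) σ)
eval-instantiate v σ (~ p) = cong not (eval-instantiate v σ p)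
eval-instantiate v σ (p & q) = cong₂ _∧_ (eval-instantiate v σ p) (eval-instantiate v σ q)
eval-instantiate v σ (p ∣∣ q) = cong₂ _∨_ (eval-instantiate v σ p) (eval-instantiate v σ q)
eval-instantiate v σ (p ⟹ q) = cong₂ (λ a b → not a ∨ b) (eval-instantiate v σ p) (eval-instantiate v σ q)

instantiate-wf : ∀ {n} (σ : Vec Formula n) p → All WfF σ → WfF (instantiate σ p)
instantiate-wf σ (atom i) ws = lookup-wf i ws
  where
  lookup-wf : ∀ {n} (i : Fin n) {σ : Vec Formula n} → All WfF σ → WfF (lookup σ i)
  lookup-wf zero (w ∷ _) = w
  lookup-wf (suc i) (_ ∷ ws) = lookup-wf i ws
instantiate-wf σ (~ p) ws = wf-¬ (instantiate-wf σ p ws)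
instantiate-wf σ (p & q) ws = wf-∧ (instantiate-wf σ p ws) (instantiate-wf σ q ws)
instantiate-wf σ (p ∣∣ q) ws = wf-∨ (instantiate-wf σ p ws) (instantiate-wf σ q ws)
instantiate-wf σ (p ⟹ q) ws = wf-∨ (wf-¬ (instantiate-wf σ p ws)) (instantiate-wf σ q ws)

allValuations : ∀ n → (Vec Bool n → Bool) → Bool
allValuations zero f = f []
allValuations (suc n) f = allValuations n (λ ρ → f (true ∷ ρ)) ∧ allValuations n (λ ρ → f (false ∷ ρ))

allValuations-sound : ∀ n f → T (allValuations n f) → ∀ ρ → f ρ ≡ true
allValuations-sound zero f ok [] with f [] | ok
... | true | _ = refl
allValuations-sound (suc n) f ok (b ∷ ρ)
  with allValuations n (λ ρ → f (true ∷ ρ)) in eq | b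
... | true | true = allValuations-sound n _ (subst T (sym eq) _) ρ
... | true | false = allValuations-sound n _ ok ρ

_⟹*_ : ∀ {n} → List (PropForm n) → PropForm n → PropForm n
[] ⟹* c = c
(p ∷ ps) ⟹* c = p ⟹ (ps ⟹* c)

AllProvable : ∀ {n} → Vec Formula n → List (PropForm n) → Set
AllProvable σ [] = ⊤
AllProvable σ (p ∷ ps) = (RST⊢ instantiate σ p) × AllProvable σ ps

mp* : ∀ {n} (σ : Vec Formula n) ps c → RST⊢ instantiate σ (ps ⟹* c) → AllProvable σ ps → RST⊢ instantiate σ c
mp* σ [] c q _ = q
mp* σ (p ∷ ps) c q (⊢p , ⊢ps) = mp* σ ps c (mp ⊢p q) ⊢ps

tautology : ∀ {n} (σ : Vec Formula n) (ps : List (PropForm n)) (c : PropForm n)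
            {ok : T (allValuations n (λ ρ → evalProp ρ (ps ⟹* c)))} →
            All WfF σ → AllProvable σ ps → RST⊢ instantiate σ c
tautology {n} σ ps c {ok} ws ⊢ps =
  mp* σ ps c (taut (instantiate-wf σ (ps ⟹* c) ws)
                   (λ v → trans (eval-instantiate v σ (ps ⟹* c))
                                (allValuations-sound n _ ok (map (eval v) σ)))) ⊢ps

allWf? : ∀ {n} (σ : Vec Formula n) → Maybe (All WfF σ)
allWf? [] = just []
allWf? (φ ∷ σ) with wfF? φ | allWf? σ
... | just w | just ws = just (w ∷ ws)
... | _ | _ = nothing

tautology! : ∀ {n} (σ : Vec Formula n) (ps : List (PropForm n)) (c : PropForm n)
             {ok : T (allValuations n (λ ρ → evalProp ρ (ps ⟹* c)))} {wf : Succeeds (allWf? σ)} →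
             AllProvable σ ps → RST⊢ instantiate σ c
tautology! σ ps c {ok} {wf} = tautology σ ps c {ok} (to-witness-T (allWf? σ) wf)

-- Derived rules

infix 3 ⊢_
⊢_ : Formula → Set
⊢ φ = RST⊢ φ

wf⇒ : ∀ {A B} → WfF (A ⇒ₛ B) → WfF A × WfF B
wf⇒ (wf-∨ (wf-¬ wA) wB) = wA , wB

axiom-wf : ∀ {φ} → RSTAxiom φ → WfF φ
axiom-wf extensionality = wfF!
axiom-wf (comprehension x φ (wf-abs d)) =
  let wφ = safe⇒wf d ; w∈ = wf-∈ (wf-var x) (wf-abs d) in
  wf-¬ (wf-∃ x (wf-¬ (wf-∧ (wf-∨ (wf-¬ w∈) wφ) (wf-∨ (wf-¬ wφ) w∈))))
axiom-wf hf-empty = wfF!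
axiom-wf hf-closed = wfF!
axiom-wf hf-least = wfF!

⊢-wf : ∀ {φ} → RST⊢ φ → WfF φ
⊢-wf (taut w _) = w
⊢-wf (ax a) = axiom-wf a
⊢-wf (∃-ax {φ} {t} x w wt ff) = wf-∨ (wf-¬ (subF-wf φ wt ff w)) (wf-∃ x w)
⊢-wf (eq-refl x) = wf-≐ (wf-var x) (wf-var x)
⊢-wf (eq-subst {φ} z w ws wt ffs fft) = wf-∨ (wf-¬ (wf-≐ ws wt)) (wf-∨ (wf-¬ (subF-wf φ ws ffs w)) (subF-wf φ wt fft w))
⊢-wf (mp _ q) = proj₂ (wf⇒ (⊢-wf q))
⊢-wf (∃-intro x p _) = wf-∨ (wf-¬ (wf-∃ x (proj₁ (wf⇒ (⊢-wf p))))) (proj₂ (wf⇒ (⊢-wf p)))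

¬-wf⁻ : ∀ {A} → WfF (¬ₛ A) → WfF A
¬-wf⁻ (wf-¬ w) = w

∃-wf⁻ : ∀ {x A} → WfF (∃ₛ x A) → WfF A
∃-wf⁻ (wf-∃ _ w) = w

∧-wf⁻ : ∀ {A B} → WfF (A ∧ₛ B) → WfF A × WfF B
∧-wf⁻ (wf-∧ wA wB) = wA , wB

∀-wf⁻ : ∀ {x A} → WfF (∀ₛ x A) → WfF A
∀-wf⁻ = ¬-wf⁻ ∘ ∃-wf⁻ ∘ ¬-wf⁻

⇒-wfˡ : ∀ {A B} → ⊢ A ⇒ₛ B → WfF A
⇒-wfˡ p = proj₁ (wf⇒ (⊢-wf p))

⇒-wfʳ : ∀ {A B} → ⊢ A ⇒ₛ B → WfF B
⇒-wfʳ p = proj₂ (wf⇒ (⊢-wf p))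

⇒-trans : ∀ {A B C} → ⊢ A ⇒ₛ B → ⊢ B ⇒ₛ C → ⊢ A ⇒ₛ C
⇒-trans {A} {B} {C} p q =
  tautology (A ∷ B ∷ C ∷ []) ((0 ⟹ 1) ∷ (1 ⟹ 2) ∷ []) (0 ⟹ 2) (⇒-wfˡ p ∷ ⇒-wfʳ p ∷ ⇒-wfʳ q ∷ []) (p , q , tt)

mp-under : ∀ {H A B} → ⊢ H ⇒ₛ A → ⊢ H ⇒ₛ (A ⇒ₛ B) → ⊢ H ⇒ₛ B
mp-under {H} {A} {B} p q =
  tautology (H ∷ A ∷ B ∷ []) ((0 ⟹ 1) ∷ (0 ⟹ 1 ⟹ 2) ∷ []) (0 ⟹ 2)
    (⇒-wfˡ p ∷ ⇒-wfʳ p ∷ proj₂ (wf⇒ (⇒-wfʳ q)) ∷ []) (p , q , tt)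

∧-intro-under : ∀ {H A B} → ⊢ H ⇒ₛ A → ⊢ H ⇒ₛ B → ⊢ H ⇒ₛ (A ∧ₛ B)
∧-intro-under {H} {A} {B} p q =
  tautology (H ∷ A ∷ B ∷ []) ((0 ⟹ 1) ∷ (0 ⟹ 2) ∷ []) (0 ⟹ 1 & 2) (⇒-wfˡ p ∷ ⇒-wfʳ p ∷ ⇒-wfʳ q ∷ []) (p , q , tt)

weaken : ∀ {H A} → WfF H → ⊢ A → ⊢ H ⇒ₛ A
weaken {H} {A} wH p = tautology (H ∷ A ∷ []) (1 ∷ []) (0 ⟹ 1) (wH ∷ ⊢-wf p ∷ []) (p , tt)

⇒-curry : ∀ {Γ A B} → ⊢ (Γ ∧ₛ A) ⇒ₛ B → ⊢ Γ ⇒ₛ (A ⇒ₛ B)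
⇒-curry {Γ} {A} {B} p = let (wΓ , wA) = ∧-wf⁻ (⇒-wfˡ p) in
  tautology (Γ ∷ A ∷ B ∷ []) ((0 & 1 ⟹ 2) ∷ []) (0 ⟹ 1 ⟹ 2) (wΓ ∷ wA ∷ ⇒-wfʳ p ∷ []) (p , tt)

∧-weaken : ∀ {Γ A X} → WfF A → ⊢ Γ ⇒ₛ X → ⊢ (Γ ∧ₛ A) ⇒ₛ X
∧-weaken {Γ} {A} {X} wA p =
  tautology (Γ ∷ A ∷ X ∷ []) ((0 ⟹ 2) ∷ []) (0 & 1 ⟹ 2) (⇒-wfˡ p ∷ wA ∷ ⇒-wfʳ p ∷ []) (p , tt)

∧-assumption : ∀ {Γ A} → WfF Γ → WfF A → ⊢ (Γ ∧ₛ A) ⇒ₛ A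
∧-assumption {Γ} {A} wΓ wA = tautology (Γ ∷ A ∷ []) [] (0 & 1 ⟹ 1) (wΓ ∷ wA ∷ []) tt

∀-elim : ∀ x {φ} t → WfF φ → WfT t → FreeForF x t φ → ⊢ ∀ₛ x φ ⇒ₛ subF x t φ
∀-elim x {φ} t wφ wt ff =
  let p = ∃-ax x (wf-¬ wφ) wt ff in
  tautology (subF x t φ ∷ ∃ₛ x (¬ₛ φ) ∷ []) ((~ 0 ⟹ 1) ∷ []) (~ 1 ⟹ 0) (¬-wf⁻ (⇒-wfˡ p) ∷ ⇒-wfʳ p ∷ []) (p , tt)

∀-elim-under : ∀ x {H φ} t → WfT t → FreeForF x t φ → ⊢ H ⇒ₛ ∀ₛ x φ → ⊢ H ⇒ₛ subF x t φ
∀-elim-under x t wt ff p = ⇒-trans p (∀-elim x t (∀-wf⁻ (⇒-wfʳ p)) wt ff)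

∀-intro-under : ∀ x {H φ} → ⊢ H ⇒ₛ φ → x ∉ fvF H → ⊢ H ⇒ₛ ∀ₛ x φ
∀-intro-under x {H} {φ} p x∉H =
  let q = tautology (H ∷ φ ∷ []) ((0 ⟹ 1) ∷ []) (~ 1 ⟹ ~ 0) (⇒-wfˡ p ∷ ⇒-wfʳ p ∷ []) (p , tt)
      r = ∃-intro x q x∉H
  in tautology (H ∷ ∃ₛ x (¬ₛ φ) ∷ []) ((1 ⟹ ~ 0) ∷ []) (0 ⟹ ~ 1) (⇒-wfˡ p ∷ ⇒-wfˡ r ∷ []) (r , tt)

-- A closed tautology: it serves as an empty context, and its negation as a closed falsum.
⊤ₛ : Formula
⊤ₛ = HF ≐ HF ⇒ₛ HF ≐ HF

⊥ₛ : Formula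
⊥ₛ = ¬ₛ ⊤ₛ

⊢⊤ₛ : ⊢ ⊤ₛ
⊢⊤ₛ = tautology! (HF ≐ HF ∷ []) [] (0 ⟹ 0) tt

∀-intro : ∀ x {φ} → ⊢ φ → ⊢ ∀ₛ x φ
∀-intro x p = mp ⊢⊤ₛ (∀-intro-under x (weaken wfF! p) λ ())

∃-elim-under : ∀ x {H φ ψ} → ⊢ H ⇒ₛ (φ ⇒ₛ ψ) → x ∉ fvF H → x ∉ fvF ψ → ⊢ H ⇒ₛ (∃ₛ x φ ⇒ₛ ψ)
∃-elim-under x {H} {φ} {ψ} p x∉H x∉ψ =
  let (wφ , wψ) = wf⇒ (⇒-wfʳ p)
      q = tautology (H ∷ φ ∷ ψ ∷ []) ((0 ⟹ 1 ⟹ 2) ∷ []) (1 ⟹ 0 ⟹ 2) (⇒-wfˡ p ∷ wφ ∷ wψ ∷ []) (p , tt)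
      r = ∃-intro x q (∉-++ x∉H x∉ψ)
  in tautology (H ∷ ∃ₛ x φ ∷ ψ ∷ []) ((1 ⟹ 0 ⟹ 2) ∷ []) (0 ⟹ 1 ⟹ 2) (⇒-wfˡ p ∷ ⇒-wfˡ r ∷ wψ ∷ []) (r , tt)

¬∃-intro-under : ∀ x {Γ φ} → ⊢ Γ ⇒ₛ ¬ₛ φ → x ∉ fvF Γ → ⊢ Γ ⇒ₛ ¬ₛ (∃ₛ x φ)
¬∃-intro-under x {Γ} {φ} p x∉Γ =
  let q = tautology (Γ ∷ φ ∷ HF ≐ HF ∷ []) ((0 ⟹ ~ 1) ∷ []) (0 ⟹ 1 ⟹ ~ (2 ⟹ 2))
            (⇒-wfˡ p ∷ ¬-wf⁻ (⇒-wfʳ p) ∷ wfF! ∷ []) (p , tt)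
      r = ∃-elim-under x {ψ = ⊥ₛ} q x∉Γ λ ()
  in tautology (Γ ∷ ∃ₛ x φ ∷ HF ≐ HF ∷ []) ((0 ⟹ 1 ⟹ ~ (2 ⟹ 2)) ∷ []) (0 ⟹ ~ 1)
       (⇒-wfˡ p ∷ proj₁ (wf⇒ (⇒-wfʳ r)) ∷ wfF! ∷ []) (r , tt)

¬∃-intro : ∀ x {φ} → ⊢ ¬ₛ φ → ⊢ ¬ₛ (∃ₛ x φ)
¬∃-intro x p = mp ⊢⊤ₛ (¬∃-intro-under x (weaken wfF! p) λ ())

∀∈-elim-under : ∀ {Γ} y t ψ u → WfF ψ → WfT t → FreeForF y (var u) (var y ∈ₛ t ∧ₛ ¬ₛ ψ) →
                ⊢ Γ ⇒ₛ ∀∈ y t ψ → ⊢ Γ ⇒ₛ (subF y (var u) (var y ∈ₛ t) ⇒ₛ subF y (var u) ψ)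
∀∈-elim-under {Γ} y t ψ u wψ wt ff p =
  let e = ∃-ax y (wf-∧ (wf-∈ (wf-var y) wt) (wf-¬ wψ)) (wf-var u) ff
      (w∈ , w¬ψ) = ∧-wf⁻ (⇒-wfˡ e)
  in tautology (Γ ∷ subF y (var u) (var y ∈ₛ t) ∷ subF y (var u) ψ ∷ ∃ₛ y (var y ∈ₛ t ∧ₛ ¬ₛ ψ) ∷ [])
       ((0 ⟹ ~ 3) ∷ (1 & ~ 2 ⟹ 3) ∷ []) (0 ⟹ 1 ⟹ 2)
       (⇒-wfˡ p ∷ w∈ ∷ ¬-wf⁻ w¬ψ ∷ ⇒-wfʳ e ∷ []) (p , e , tt)

∃-rename : ∀ a b φ → WfF φ → FreeForF b (var a) φ → a ∉ fvF (∃ₛ b φ) → ⊢ ∃ₛ a (subF b (var a) φ) ⇒ₛ ∃ₛ b φ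
∃-rename a b φ wφ ff a∉ = ∃-intro a (∃-ax b wφ (wf-var a) ff) a∉

¬∃-rename : ∀ a b φ → WfF φ → FreeForF b (var a) φ → a ∉ fvF (∃ₛ b φ) →
            ⊢ ¬ₛ (∃ₛ b φ) ⇒ₛ ¬ₛ (∃ₛ a (subF b (var a) φ))
¬∃-rename a b φ wφ ff a∉ =
  tautology (∃ₛ a (subF b (var a) φ) ∷ ∃ₛ b φ ∷ []) ((0 ⟹ 1) ∷ []) (~ 1 ⟹ ~ 0) (⇒-wfˡ renamed ∷ ⇒-wfʳ renamed ∷ [])
    (renamed , tt)
  where
  renamed = ∃-rename a b φ wφ ff a∉

≐-refl : ∀ {t} → WfT t → ⊢ t ≐ t
≐-refl {t} wt = mp (∀-intro 0 (eq-refl 0)) (∀-elim 0 t wfF! wt (tt , tt))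

subF-var≐ : ∀ z t s → z ∉ fvT s → subF z t (var z ≐ s) ≡ (t ≐ s)
subF-var≐ z t s z∉s rewrite ≡ᵇ-refl z | subT-notFree z t s z∉s = refl

subF-var∈ : ∀ z t s → z ∉ fvT s → subF z t (var z ∈ₛ s) ≡ (t ∈ₛ s)
subF-var∈ z t s z∉s rewrite ≡ᵇ-refl z | subT-notFree z t s z∉s = refl

≐-sym : ∀ {s t} → WfT s → WfT t → ⊢ s ≐ t ⇒ₛ t ≐ s
≐-sym {s} {t} ws wt =
  tautology (s ≐ t ∷ s ≐ s ∷ t ≐ s ∷ []) ((0 ⟹ 1 ⟹ 2) ∷ 1 ∷ []) (0 ⟹ 2)
    (wf-≐ ws wt ∷ wf-≐ ws ws ∷ wf-≐ wt ws ∷ []) (leibniz , ≐-refl ws , tt)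
  where
  z = fresh (fvT s)
  z∉s = fresh-∉ (fvT s)
  leibniz : ⊢ s ≐ t ⇒ₛ (s ≐ s ⇒ₛ t ≐ s)
  leibniz = subst₂ (λ A B → ⊢ s ≐ t ⇒ₛ (A ⇒ₛ B)) (subF-var≐ z s s z∉s) (subF-var≐ z t s z∉s)
              (eq-subst {var z ≐ s} z (wf-≐ (wf-var z) ws) ws wt
                 (tt , freeForT-notFree s z∉s) (tt , freeForT-notFree s z∉s))

≐-subst-∈ : ∀ {s t X} → WfT s → WfT t → WfT X → ⊢ s ≐ t ⇒ₛ (s ∈ₛ X ⇒ₛ t ∈ₛ X)
≐-subst-∈ {s} {t} {X} ws wt wX =
  subst₂ (λ A B → ⊢ s ≐ t ⇒ₛ (A ⇒ₛ B)) (subF-var∈ z s X z∉X) (subF-var∈ z t X z∉X)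
    (eq-subst {var z ∈ₛ X} z (wf-∈ (wf-var z) wX) ws wt (tt , freeForT-notFree X z∉X) (tt , freeForT-notFree X z∉X))
  where
  z = fresh (fvT X)
  z∉X = fresh-∉ (fvT X)

comprehension-inst : ∀ {x φ t} → WfT (abs x φ) → WfT t → FreeForF x t φ → ⊢ t ∈ₛ abs x φ ⇔ₛ subF x t φ
comprehension-inst {x} {φ} {t} w wt ff =
  subst (λ A → ⊢ A ⇔ₛ subF x t φ) (subF-var∈ x t (abs x φ) x∉)
    (mp (ax (comprehension x φ w)) (∀-elim x t (∀-wf⁻ (axiom-wf (comprehension x φ w))) wt ((ff∈ , ff) , (ff , ff∈))))
  where
  x∉ : x ∉ fvT (abs x φ)
  x∉ = ∉-remove (fvF φ)
  ff∈ : FreeForF x t (var x ∈ₛ abs x φ)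
  ff∈ = tt , inj₁ x∉

∀-elim! : ∀ {x φ} → ⊢ ∀ₛ x φ → (t : Term) {wt : Succeeds (wfT? t)} {ff : Succeeds (freeForF? x t φ)} →
          ⊢ subF x t φ
∀-elim! {x} {φ} p t {wt} {ff} = mp p (∀-elim x t (∀-wf⁻ (⊢-wf p)) (wfT! {t} {wt}) (freeForF! {x} {t} {φ} {ff}))

∀-elim-under! : ∀ {H x φ} → ⊢ H ⇒ₛ ∀ₛ x φ → (t : Term) {wt : Succeeds (wfT? t)} {ff : Succeeds (freeForF? x t φ)} →
                ⊢ H ⇒ₛ subF x t φ
∀-elim-under! {x = x} {φ} p t {wt} {ff} = ∀-elim-under x t (wfT! {t} {wt}) (freeForF! {x} {t} {φ} {ff}) p

∃-ax! : ∀ x φ t {wφ : Succeeds (wfF? φ)} {wt : Succeeds (wfT? t)} {ff : Succeeds (freeForF? x t φ)} →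
        ⊢ subF x t φ ⇒ₛ ∃ₛ x φ
∃-ax! x φ t {wφ} {wt} {ff} = ∃-ax x (wfF! {φ} {wφ}) (wfT! {t} {wt}) (freeForF! {x} {t} {φ} {ff})

eq-subst! : ∀ z φ s t {wφ : Succeeds (wfF? φ)} {ws : Succeeds (wfT? s)} {wt : Succeeds (wfT? t)}
            {ffs : Succeeds (freeForF? z s φ)} {fft : Succeeds (freeForF? z t φ)} →
            ⊢ s ≐ t ⇒ₛ (subF z s φ ⇒ₛ subF z t φ)
eq-subst! z φ s t {wφ} {ws} {wt} {ffs} {fft} =
  eq-subst z (wfF! {φ} {wφ}) (wfT! {s} {ws}) (wfT! {t} {wt}) (freeForF! {z} {s} {φ} {ffs}) (freeForF! {z} {t} {φ} {fft})

≐-sym! : ∀ s t {ws : Succeeds (wfT? s)} {wt : Succeeds (wfT? t)} → ⊢ s ≐ t ⇒ₛ t ≐ s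
≐-sym! s t {ws} {wt} = ≐-sym (wfT! {s} {ws}) (wfT! {t} {wt})

∀∈-elim-under! : ∀ {Γ} y t ψ u {wψ : Succeeds (wfF? ψ)} {wt : Succeeds (wfT? t)}
                 {ff : Succeeds (freeForF? y (var u) (var y ∈ₛ t ∧ₛ ¬ₛ ψ))} →
                 ⊢ Γ ⇒ₛ ∀∈ y t ψ → ⊢ Γ ⇒ₛ (subF y (var u) (var y ∈ₛ t) ⇒ₛ subF y (var u) ψ)
∀∈-elim-under! y t ψ u {wψ} {wt} {ff} =
  ∀∈-elim-under y t ψ u (wfF! {ψ} {wψ}) (wfT! {t} {wt}) (freeForF! {y} {var u} {var y ∈ₛ t ∧ₛ ¬ₛ ψ} {ff})

∃-rename! : ∀ a b φ {wφ : Succeeds (wfF? φ)} {ff : Succeeds (freeForF? b (var a) φ)}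
            {a∉ : Succeeds (∉? a (fvF (∃ₛ b φ)))} →
            ⊢ ∃ₛ a (subF b (var a) φ) ⇒ₛ ∃ₛ b φ
∃-rename! a b φ {wφ} {ff} {a∉} =
  ∃-rename a b φ (wfF! {φ} {wφ}) (freeForF! {b} {var a} {φ} {ff}) (∉! {a} {fvF (∃ₛ b φ)} {a∉})

comprehension! : ∀ x φ t {w : Succeeds (wfT? (abs x φ))} {wt : Succeeds (wfT? t)} {ff : Succeeds (freeForF? x t φ)} →
                 ⊢ t ∈ₛ abs x φ ⇔ₛ subF x t φ
comprehension! x φ t {w} {wt} {ff} = comprehension-inst (wfT! {abs x φ} {w}) (wfT! {t} {wt}) (freeForF! {x} {t} {φ} {ff})

-- Adjoining an element

-- t ∪ {s} with explicit bound variables; Sₛ a is adjoin z z′ a a for the fresh z, z′ chosen in Sₛ.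
adjoin : ℕ → ℕ → Term → Term → Term
adjoin b₁ b₂ t s = abs b₁ (var b₁ ∈ₛ t ∨ₛ var b₁ ∈ₛ abs b₂ (var b₂ ≐ s))

record FreshBinders (b₁ b₂ p q : ℕ) : Set where
  constructor fresh-binders
  field
    b₁≢p : b₁ ≢ p
    b₂≢q : b₂ ≢ q
    b₁≢q : b₁ ≡ b₂ ⊎ b₁ ≢ q

module _ {b₁ b₂ p q : ℕ} (ok : FreshBinders b₁ b₂ p q) where

  open FreshBinders ok

  private
    b₁∉sing : b₁ ∉ fvT (abs b₂ (var b₂ ≐ var q))
    b₁∉sing r with ∈-remove⁻ (b₂ ∷ q ∷ []) r
    ... | here e , b₁≢b₂ = b₁≢b₂ e
    ... | there (here e) , b₁≢b₂ = [ b₁≢b₂ , (λ b₁≢q → b₁≢q e) ] b₁≢q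

    sing-wf : WfT (abs b₂ (var b₂ ≐ var q))
    sing-wf = wf-abs (≻-x=t (wf-var q) λ { (here e) → b₂≢q e })

  adjoin-wf : WfT (adjoin b₁ b₂ (var p) (var q))
  adjoin-wf = wf-abs (≻-∨ (≻-x∈t (wf-var p) λ { (here e) → b₁≢p e }) (≻-x∈t sing-wf b₁∉sing))

  ∈-adjoin : ∀ u → ⊢ var u ∈ₛ adjoin b₁ b₂ (var p) (var q) ⇔ₛ (var u ∈ₛ var p ∨ₛ var u ≐ var q)
  ∈-adjoin u =
    tautology (var u ∈ₛ adjoin b₁ b₂ (var p) (var q) ∷ var u ∈ₛ var p ∷ var u ∈ₛ abs b₂ (var b₂ ≐ var q) ∷ var u ≐ var q ∷ [])
      ((0 ⟺ 1 ∣∣ 2) ∷ (2 ⟺ 3) ∷ []) (0 ⟺ 1 ∣∣ 3)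
      (wf-∈ (wf-var u) adjoin-wf ∷ wf-∈ (wf-var u) (wf-var p) ∷ wf-∈ (wf-var u) sing-wf ∷ wf-≐ (wf-var u) (wf-var q) ∷ [])
      (∈adjoin⇔ , ∈sing⇔ , tt)
    where
    ∈adjoin⇔ : ⊢ var u ∈ₛ adjoin b₁ b₂ (var p) (var q) ⇔ₛ (var u ∈ₛ var p ∨ₛ var u ∈ₛ abs b₂ (var b₂ ≐ var q))
    ∈adjoin⇔ = subst (λ A → ⊢ var u ∈ₛ adjoin b₁ b₂ (var p) (var q) ⇔ₛ A)
                 (cong₂ _∨ₛ_ (subF-var∈ b₁ (var u) (var p) λ { (here e) → b₁≢p e }) (subF-var∈ b₁ (var u) _ b₁∉sing))
                 (comprehension-inst adjoin-wf (wf-var u) ((tt , tt) , (tt , inj₁ b₁∉sing)))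
    ∈sing⇔ : ⊢ var u ∈ₛ abs b₂ (var b₂ ≐ var q) ⇔ₛ var u ≐ var q
    ∈sing⇔ = subst (λ A → ⊢ var u ∈ₛ abs b₂ (var b₂ ≐ var q) ⇔ₛ A) (subF-var≐ b₂ (var u) (var q) λ { (here e) → b₂≢q e })
               (comprehension-inst sing-wf (wf-var u) (tt , tt))

∈-fv-adjoin : ∀ b₁ b₂ p q {v} → v ∈ fvT (adjoin b₁ b₂ (var p) (var q)) → v ≡ p ⊎ v ≡ q
∈-fv-adjoin b₁ b₂ p q r with ∈-remove⁻ (b₁ ∷ p ∷ b₁ ∷ remove b₂ (b₂ ∷ q ∷ [])) r
... | here e , v≢b₁ = ⊥-elim (v≢b₁ e)
... | there (here e) , _ = inj₁ e
... | there (there (here e)) , v≢b₁ = ⊥-elim (v≢b₁ e)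
... | there (there (there r′)) , _ with ∈-remove⁻ (b₂ ∷ q ∷ []) r′
...   | here e , v≢b₂ = ⊥-elim (v≢b₂ e)
...   | there (here e) , _ = inj₂ e

subT-adjoin : ∀ b₁ b₂ x t → b₁ ≢ x → b₂ ≢ x → subT x t (adjoin b₁ b₂ (var x) (var x)) ≡ adjoin b₁ b₂ t t
subT-adjoin b₁ b₂ x t b₁≢x b₂≢x rewrite ≢⇒≡ᵇ-false b₁≢x | ≢⇒≡ᵇ-false b₂≢x | ≡ᵇ-refl x = refl

extensionality-inst : ∀ {U V} → WfT U → WfT V → Disjoint (fvT U) (1 ∷ 2 ∷ []) → 2 ∉ fvT V →
                      ⊢ ∀ₛ 2 (var 2 ∈ₛ U ⇔ₛ var 2 ∈ₛ V) ⇒ₛ U ≐ V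
extensionality-inst {U} {V} wU wV U-avoids 2∉V =
  subst (λ W → ⊢ ∀ₛ 2 (var 2 ∈ₛ W ⇔ₛ var 2 ∈ₛ V) ⇒ₛ W ≐ V) (subT-notFree 1 V U 1∉U)
    (mp (mp (ax extensionality) (∀-elim 0 {ext} U wfF! wU (freeForF-bv 0 U ext U-avoids))) (∀-elim 1 V wbody wV ff))
  where
  ext = ∀ₛ 1 (∀ₛ 2 (var 2 ∈ₛ var 0 ⇔ₛ var 2 ∈ₛ var 1) ⇒ₛ var 0 ≐ var 1)
  1∉U : 1 ∉ fvT U
  1∉U p = U-avoids 1 p (here refl)
  ffU : FreeForT 1 V U
  ffU = freeForT-notFree U 1∉U
  w2∈U = wf-∈ (wf-var 2) wU
  w2∈1 = wf-∈ (wf-var 2) (wf-var 1)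
  wbody : WfF (∀ₛ 2 (var 2 ∈ₛ U ⇔ₛ var 2 ∈ₛ var 1) ⇒ₛ U ≐ var 1)
  wbody = wf-∨ (wf-¬ (wf-¬ (wf-∃ 2 (wf-¬ (wf-∧ (wf-∨ (wf-¬ w2∈U) w2∈1) (wf-∨ (wf-¬ w2∈1) w2∈U))))))
               (wf-≐ wU (wf-var 1))
  ff : FreeForF 1 V (∀ₛ 2 (var 2 ∈ₛ U ⇔ₛ var 2 ∈ₛ var 1) ⇒ₛ U ≐ var 1)
  ff = inj₂ (2∉V , (((tt , ffU) , (tt , tt)) , ((tt , tt) , (tt , ffU)))) , (ffU , tt)

adjoin-≐ : ∀ {b₁ b₂ c₁ c₂ p q} → FreshBinders b₁ b₂ p q → FreshBinders c₁ c₂ p q → Disjoint (p ∷ q ∷ []) (1 ∷ 2 ∷ []) →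
           ⊢ adjoin b₁ b₂ (var p) (var q) ≐ adjoin c₁ c₂ (var p) (var q)
adjoin-≐ {b₁} {b₂} {c₁} {c₂} {p} {q} okb okc pq-avoid =
  mp (∀-intro 2 (tautology (var 2 ∈ₛ U ∷ var 2 ∈ₛ V ∷ var 2 ∈ₛ var p ∷ var 2 ≐ var q ∷ [])
                   ((0 ⟺ 2 ∣∣ 3) ∷ (1 ⟺ 2 ∣∣ 3) ∷ []) (0 ⟺ 1)
                   (wf-∈ (wf-var 2) (adjoin-wf okb) ∷ wf-∈ (wf-var 2) (adjoin-wf okc) ∷
                    wf-∈ (wf-var 2) (wf-var p) ∷ wf-≐ (wf-var 2) (wf-var q) ∷ [])
                   (∈-adjoin okb 2 , ∈-adjoin okc 2 , tt)))
     (extensionality-inst (adjoin-wf okb) (adjoin-wf okc) (λ w w∈U → fv-avoids b₁ b₂ w∈U)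
                          (λ 2∈V → fv-avoids c₁ c₂ 2∈V (there (here refl))))
  where
  U = adjoin b₁ b₂ (var p) (var q)
  V = adjoin c₁ c₂ (var p) (var q)
  fv-avoids : ∀ d₁ d₂ {w} → w ∈ fvT (adjoin d₁ d₂ (var p) (var q)) → w ∉ 1 ∷ 2 ∷ []
  fv-avoids d₁ d₂ w∈ with ∈-fv-adjoin d₁ d₂ p q w∈
  ... | inj₁ refl = pq-avoid p (here refl)
  ... | inj₂ refl = pq-avoid q (there (here refl))

fv-adjoin-diag : ∀ b₁ b₂ p {w} → w ∈ fvT (adjoin b₁ b₂ (var p) (var p)) → w ≡ p
fv-adjoin-diag b₁ b₂ p w∈ = [ (λ e → e) , (λ e → e) ] (∈-fv-adjoin b₁ b₂ p p w∈)

-- Tame sets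

infix 7 _∈ᵛ_ _≐ᵛ_

_∈ᵛ_ : ℕ → ℕ → Formula
a ∈ᵛ b = var a ∈ₛ var b

_≐ᵛ_ : ℕ → ℕ → Formula
a ≐ᵛ b = var a ≐ var b

-- S(var v), with the bound variables 3 and 1 that the unfolding of Nₛ produces.
suc₃ : ℕ → Term
suc₃ v = adjoin 3 3 (var v) (var v)

suc₁ : ℕ → Term
suc₁ v = adjoin 1 1 (var v) (var v)

N[_] : ℕ → Formula
N[ u ] = subF 0 (var u) (Nₛ (var 0))

SucOfElem : ℕ → ℕ → Formula
SucOfElem v y = ∃ₛ 2 (2 ∈ᵛ v ∧ₛ var y ≐ suc₃ 2)

ZeroOrSuc : ℕ → ℕ → Formula
ZeroOrSuc v y = var y ≐ ∅ₛ ∨ₛ SucOfElem v y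

No2Cycle : ℕ → Formula
No2Cycle u = ¬ₛ (∃ₛ 8 (8 ∈ᵛ u ∧ₛ u ∈ᵛ 8))

-- var 9 stands for an arbitrary set C containing ∅ and closed under S on HF.
Tame : ℕ → Formula
Tame u = var u ∈ₛ HF ∧ₛ (¬ₛ (u ∈ᵛ u) ∧ₛ (No2Cycle u ∧ₛ (N[ u ] ⇒ₛ u ∈ᵛ 9)))

AllTame : ℕ → Formula
AllTame v = ∀∈ 7 (var v) (Tame 7)

HFAllTame : ℕ → Formula
HFAllTame v = var v ∈ₛ HF ∧ₛ AllTame v

Tames : Term
Tames = abs 4 (HFAllTame 4)

SucClosed : Formula
SucClosed = ∅ₛ ∈ₛ var 9 ∧ₛ ∀ₛ 5 ((5 ∈ᵛ 9 ∧ₛ var 5 ∈ₛ HF) ⇒ₛ suc₃ 5 ∈ₛ var 9)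

∈Tames⇔ : ∀ v {ff : Succeeds (freeForF? 4 (var v) (HFAllTame 4))} → ⊢ var v ∈ₛ Tames ⇔ₛ subF 4 (var v) (HFAllTame 4)
∈Tames⇔ v {ff} = comprehension! 4 (HFAllTame 4) (var v) {ff = ff}

module TameMembers where

  Γ : Formula
  Γ = SucClosed ∧ₛ var 6 ∈ₛ Tames

  HF∧AllTame : ⊢ Γ ⇒ₛ HFAllTame 6
  HF∧AllTame = tautology! (SucClosed ∷ var 6 ∈ₛ Tames ∷ HFAllTame 6 ∷ []) ((1 ⟺ 2) ∷ []) (0 & 1 ⟹ 2) (∈Tames⇔ 6 , tt)

  inHF : ⊢ Γ ⇒ₛ var 6 ∈ₛ HF
  inHF = tautology! (Γ ∷ var 6 ∈ₛ HF ∷ AllTame 6 ∷ []) ((0 ⟹ 1 & 2) ∷ []) (0 ⟹ 1) (HF∧AllTame , tt)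

  element-tame : ∀ u {ff : Succeeds (freeForF? 7 (var u) (var 7 ∈ₛ var 6 ∧ₛ ¬ₛ (Tame 7)))} → ⊢ Γ ⇒ₛ (u ∈ᵛ 6 ⇒ₛ Tame u)
  element-tame u {ff} =
    ∀∈-elim-under! 7 (var 6) (Tame 7) u {ff = ff}
      (tautology! (Γ ∷ var 6 ∈ₛ HF ∷ AllTame 6 ∷ []) ((0 ⟹ 1 & 2) ∷ []) (0 ⟹ 2) (HF∧AllTame , tt))

  ∉self : ⊢ Γ ⇒ₛ ¬ₛ (6 ∈ᵛ 6)
  ∉self = tautology! (Γ ∷ 6 ∈ᵛ 6 ∷ var 6 ∈ₛ HF ∷ No2Cycle 6 ∷ (N[ 6 ] ⇒ₛ 6 ∈ᵛ 9) ∷ [])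
            ((0 ⟹ 1 ⟹ 2 & ~ 1 & 3 & 4) ∷ []) (0 ⟹ ~ 1) (element-tame 6 , tt)

  no2Cycle : ⊢ Γ ⇒ₛ No2Cycle 6
  no2Cycle =
    tautology! (Γ ∷ ∃ₛ 8 (8 ∈ᵛ 6 ∧ₛ 6 ∈ᵛ 8) ∷ ∃ₛ 10 (10 ∈ᵛ 6 ∧ₛ 6 ∈ᵛ 10) ∷ [])
      ((0 ⟹ ~ 2) ∷ (1 ⟹ 2) ∷ []) (0 ⟹ ~ 1) (¬∃-intro-under 10 no-witness ∉! , ∃-rename! 8 10 (10 ∈ᵛ 6 ∧ₛ 6 ∈ᵛ 10) , tt)
    where
    cycle : Formula
    cycle = ∃ₛ 8 (8 ∈ᵛ 10 ∧ₛ 10 ∈ᵛ 8)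
    -- A witness w ∈ v with v ∈ w would be a tame w lying on a 2-cycle.
    no-witness : ⊢ Γ ⇒ₛ ¬ₛ (10 ∈ᵛ 6 ∧ₛ 6 ∈ᵛ 10)
    no-witness =
      tautology! (Γ ∷ 10 ∈ᵛ 6 ∷ 6 ∈ᵛ 10 ∷ var 10 ∈ₛ HF ∷ 10 ∈ᵛ 10 ∷ cycle ∷ (N[ 10 ] ⇒ₛ 10 ∈ᵛ 9) ∷ [])
        ((0 ⟹ 1 ⟹ 3 & ~ 4 & ~ 5 & 6) ∷ (2 & 1 ⟹ 5) ∷ []) (0 ⟹ ~ (1 & 2))
        (element-tame 10 , ∃-ax! 8 (8 ∈ᵛ 10 ∧ₛ 10 ∈ᵛ 8) (var 6) , tt)

  -- The successor case of N(v): v = S(w) with w ∈ v, where v is var 6 and w is var 10.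
  module SucCase where

    Γₛ : Formula
    Γₛ = (Γ ∧ₛ N[ 6 ]) ∧ₛ (10 ∈ᵛ 6 ∧ₛ var 6 ≐ suc₃ 10)

    v≡Sw : ⊢ Γₛ ⇒ₛ (10 ∈ᵛ 6 ∧ₛ var 6 ≐ suc₃ 10)
    v≡Sw = ∧-assumption wfF! wfF!

    w-tame : ⊢ Γₛ ⇒ₛ (10 ∈ᵛ 6 ⇒ₛ Tame 10)
    w-tame = ∧-weaken wfF! (∧-weaken wfF! (element-tame 10))

    Sw≐v : ⊢ var 6 ≐ suc₃ 10 ⇒ₛ suc₃ 10 ≐ var 6
    Sw≐v = ≐-sym! (var 6) (suc₃ 10)

    y∈Sw⇔ : ⊢ var 1 ∈ₛ suc₁ 10 ⇔ₛ (1 ∈ᵛ 10 ∨ₛ 1 ≐ᵛ 10)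
    y∈Sw⇔ = ∈-adjoin (fresh-binders (λ ()) (λ ()) (inj₁ refl)) 1

    -- y (var 1) is an element of S(w); N(w) asks that y be ∅ or S(u) for some u ∈ w.
    Γy : Formula
    Γy = Γₛ ∧ₛ var 1 ∈ₛ suc₁ 10

    y∈v : ⊢ Γy ⇒ₛ 1 ∈ᵛ 6
    y∈v = tautology! (Γy ∷ var 1 ∈ₛ suc₁ 10 ∷ 1 ∈ᵛ 10 ∷ 1 ≐ᵛ 10 ∷ var 1 ∈ₛ suc₃ 10 ∷ 10 ∈ᵛ 6 ∷ var 6 ≐ suc₃ 10 ∷
                      suc₃ 10 ≐ var 6 ∷ 1 ∈ᵛ 6 ∷ [])
            ((0 ⟹ 1) ∷ (1 ⟺ 2 ∣∣ 3) ∷ (4 ⟺ 2 ∣∣ 3) ∷ (0 ⟹ 5 & 6) ∷ (6 ⟹ 7) ∷ (7 ⟹ 4 ⟹ 8) ∷ []) (0 ⟹ 8)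
            (∧-assumption wfF! wfF! , y∈Sw⇔ , ∈-adjoin (fresh-binders (λ ()) (λ ()) (inj₁ refl)) 1 , ∧-weaken wfF! v≡Sw , Sw≐v ,
             eq-subst! 12 (var 1 ∈ₛ var 12) (suc₃ 10) (var 6) , tt)

    y-zero-or-suc-in-v : ⊢ Γy ⇒ₛ ZeroOrSuc 6 1
    y-zero-or-suc-in-v =
      tautology! (Γy ∷ 1 ∈ᵛ 6 ∷ var 1 ∈ₛ suc₁ 6 ∷ 1 ≐ᵛ 6 ∷ ZeroOrSuc 6 1 ∷ [])
        ((0 ⟹ 1) ∷ (2 ⟺ 1 ∣∣ 3) ∷ (0 ⟹ 2 ⟹ 4) ∷ []) (0 ⟹ 4)
        (y∈v , ∈-adjoin (fresh-binders (λ ()) (λ ()) (inj₁ refl)) 1 ,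
         ∀∈-elim-under! 1 (suc₁ 6) (ZeroOrSuc 6 1) 1 (∧-weaken wfF! (∧-weaken wfF! (∧-assumption wfF! wfF!))) , tt)

    -- y = S(u) with u ∈ v = w ∪ {w}.
    Γu : Formula
    Γu = Γy ∧ₛ (12 ∈ᵛ 6 ∧ₛ var 1 ≐ suc₃ 12)

    v≡Sw′ : ⊢ Γu ⇒ₛ (10 ∈ᵛ 6 ∧ₛ var 6 ≐ suc₃ 10)
    v≡Sw′ = ∧-weaken wfF! (∧-weaken wfF! v≡Sw)

    y≡Su : ⊢ Γu ⇒ₛ (12 ∈ᵛ 6 ∧ₛ var 1 ≐ suc₃ 12)
    y≡Su = ∧-assumption wfF! wfF!

    u∈w∨u≐w : ⊢ Γu ⇒ₛ (12 ∈ᵛ 10 ∨ₛ 12 ≐ᵛ 10)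
    u∈w∨u≐w =
      tautology! (Γu ∷ 10 ∈ᵛ 6 ∷ var 6 ≐ suc₃ 10 ∷ 12 ∈ᵛ 6 ∷ var 1 ≐ suc₃ 12 ∷ var 12 ∈ₛ suc₃ 10 ∷ 12 ∈ᵛ 10 ∷ 12 ≐ᵛ 10 ∷ [])
        ((0 ⟹ 1 & 2) ∷ (0 ⟹ 3 & 4) ∷ (2 ⟹ 3 ⟹ 5) ∷ (5 ⟺ 6 ∣∣ 7) ∷ []) (0 ⟹ 6 ∣∣ 7)
        (v≡Sw′ , y≡Su , eq-subst! 13 (var 12 ∈ₛ var 13) (var 6) (suc₃ 10) ,
         ∈-adjoin (fresh-binders (λ ()) (λ ()) (inj₁ refl)) 12 , tt)

    u∈w⇒ : ⊢ Γu ⇒ₛ (12 ∈ᵛ 10 ⇒ₛ SucOfElem 10 1)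
    u∈w⇒ = tautology! (Γu ∷ 12 ∈ᵛ 6 ∷ var 1 ≐ suc₃ 12 ∷ 12 ∈ᵛ 10 ∷ SucOfElem 10 1 ∷ [])
             ((0 ⟹ 1 & 2) ∷ (3 & 2 ⟹ 4) ∷ []) (0 ⟹ 3 ⟹ 4)
             (y≡Su , ∃-ax! 2 (2 ∈ᵛ 10 ∧ₛ var 1 ≐ suc₃ 2) (var 12) , tt)

    u≐w⇒y≐v : ⊢ Γu ⇒ₛ (12 ≐ᵛ 10 ⇒ₛ 1 ≐ᵛ 6)
    u≐w⇒y≐v =
      tautology! (Γu ∷ 12 ∈ᵛ 6 ∷ var 1 ≐ suc₃ 12 ∷ 12 ≐ᵛ 10 ∷ var 1 ≐ suc₃ 10 ∷ suc₃ 10 ≐ var 6 ∷ 1 ≐ᵛ 6 ∷ 10 ∈ᵛ 6 ∷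
                  var 6 ≐ suc₃ 10 ∷ [])
        ((0 ⟹ 1 & 2) ∷ (3 ⟹ 2 ⟹ 4) ∷ (5 ⟹ 4 ⟹ 6) ∷ (0 ⟹ 7 & 8) ∷ (8 ⟹ 5) ∷ []) (0 ⟹ 3 ⟹ 6)
        (y≡Su , eq-subst! 13 (var 1 ≐ suc₃ 13) (var 12) (var 10) , eq-subst! 13 (var 1 ≐ var 13) (suc₃ 10) (var 6) ,
         v≡Sw′ , Sw≐v , tt)

    cycle : Formula
    cycle = ∃ₛ 8 (8 ∈ᵛ 10 ∧ₛ 10 ∈ᵛ 8)

    w-regular : ⊢ Γu ⇒ₛ (¬ₛ (10 ∈ᵛ 10) ∧ₛ ¬ₛ cycle)
    w-regular =
      tautology! (Γu ∷ 10 ∈ᵛ 6 ∷ var 10 ∈ₛ HF ∷ 10 ∈ᵛ 10 ∷ cycle ∷ (N[ 10 ] ⇒ₛ 10 ∈ᵛ 9) ∷ var 6 ≐ suc₃ 10 ∷ [])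
        ((0 ⟹ 1 ⟹ 2 & ~ 3 & ~ 4 & 5) ∷ (0 ⟹ 1 & 6) ∷ []) (0 ⟹ ~ 3 & ~ 4)
        (∧-weaken wfF! (∧-weaken wfF! w-tame) , v≡Sw′ , tt)

    w∈v : ⊢ Γu ⇒ₛ 10 ∈ᵛ 6
    w∈v = tautology! (Γu ∷ 10 ∈ᵛ 6 ∷ var 6 ≐ suc₃ 10 ∷ []) ((0 ⟹ 1 & 2) ∷ []) (0 ⟹ 1) (v≡Sw′ , tt)

    -- y = v is impossible: y ∈ w would close the cycle w ∈ v ∈ w, and y = w gives w ∈ w.
    y≢v : ⊢ Γu ⇒ₛ ¬ₛ (1 ≐ᵛ 6)
    y≢v = tautology! (Γu ∷ var 1 ∈ₛ suc₁ 10 ∷ 1 ∈ᵛ 10 ∷ 1 ≐ᵛ 10 ∷ 1 ≐ᵛ 6 ∷ [])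
            ((0 ⟹ 1) ∷ (1 ⟺ 2 ∣∣ 3) ∷ (0 ⟹ 4 ⟹ ~ 2) ∷ (0 ⟹ 4 ⟹ ~ 3) ∷ []) (0 ⟹ ~ 4)
            (∧-weaken wfF! (∧-assumption wfF! wfF!) , y∈Sw⇔ , y∉w , y≢w , tt)
      where
      y∉w : ⊢ Γu ⇒ₛ (1 ≐ᵛ 6 ⇒ₛ ¬ₛ (1 ∈ᵛ 10))
      y∉w = tautology! (Γu ∷ 1 ≐ᵛ 6 ∷ 1 ∈ᵛ 10 ∷ 6 ∈ᵛ 10 ∷ 10 ∈ᵛ 6 ∷ cycle ∷ 10 ∈ᵛ 10 ∷ [])
              ((0 ⟹ ~ 6 & ~ 5) ∷ (1 ⟹ 2 ⟹ 3) ∷ (3 & 4 ⟹ 5) ∷ (0 ⟹ 4) ∷ []) (0 ⟹ 1 ⟹ ~ 2)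
              (w-regular , eq-subst! 13 (var 13 ∈ₛ var 10) (var 1) (var 6) ,
               ∃-ax! 8 (8 ∈ᵛ 10 ∧ₛ 10 ∈ᵛ 8) (var 6) , w∈v , tt)
      y≢w : ⊢ Γu ⇒ₛ (1 ≐ᵛ 6 ⇒ₛ ¬ₛ (1 ≐ᵛ 10))
      y≢w = tautology! (Γu ∷ 1 ≐ᵛ 6 ∷ 1 ≐ᵛ 10 ∷ 10 ≐ᵛ 6 ∷ 6 ≐ᵛ 10 ∷ 10 ∈ᵛ 6 ∷ 10 ∈ᵛ 10 ∷ cycle ∷ [])
              ((2 ⟹ 1 ⟹ 3) ∷ (3 ⟹ 4) ∷ (4 ⟹ 5 ⟹ 6) ∷ (0 ⟹ 5) ∷ (0 ⟹ ~ 6 & ~ 7) ∷ []) (0 ⟹ 1 ⟹ ~ 2)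
              (eq-subst! 13 (var 13 ≐ var 6) (var 1) (var 10) , ≐-sym! (var 10) (var 6) ,
               eq-subst! 13 (var 10 ∈ₛ var 13) (var 6) (var 10) , w∈v , w-regular , tt)

    y-zero-or-suc-in-w : ⊢ Γu ⇒ₛ ZeroOrSuc 10 1
    y-zero-or-suc-in-w =
      tautology! (Γu ∷ 12 ∈ᵛ 10 ∷ 12 ≐ᵛ 10 ∷ SucOfElem 10 1 ∷ 1 ≐ᵛ 6 ∷ var 1 ≐ ∅ₛ ∷ [])
        ((0 ⟹ 1 ∣∣ 2) ∷ (0 ⟹ 1 ⟹ 3) ∷ (0 ⟹ 2 ⟹ 4) ∷ (0 ⟹ ~ 4) ∷ []) (0 ⟹ 5 ∣∣ 3)
        (u∈w∨u≐w , u∈w⇒ , u≐w⇒y≐v , y≢v , tt)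

    N-pred : ⊢ Γₛ ⇒ₛ N[ 10 ]
    N-pred = ¬∃-intro-under 1 (tautology! (Γₛ ∷ var 1 ∈ₛ suc₁ 10 ∷ ZeroOrSuc 10 1 ∷ [])
                                ((0 ⟹ 1 ⟹ 2) ∷ []) (0 ⟹ ~ (1 & ~ 2)) (⇒-curry y-zero-or-suc-in-w′ , tt)) ∉!
      where
      y-suc-case : ⊢ Γy ⇒ₛ (SucOfElem 6 1 ⇒ₛ ZeroOrSuc 10 1)
      y-suc-case =
        tautology! (Γy ∷ SucOfElem 6 1 ∷ ∃ₛ 12 (12 ∈ᵛ 6 ∧ₛ var 1 ≐ suc₃ 12) ∷ ZeroOrSuc 10 1 ∷ [])
          ((0 ⟹ 2 ⟹ 3) ∷ (1 ⟹ 2) ∷ []) (0 ⟹ 1 ⟹ 3)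
          (∃-elim-under 12 (⇒-curry y-zero-or-suc-in-w) ∉! ∉! , ∃-rename! 2 12 (12 ∈ᵛ 6 ∧ₛ var 1 ≐ suc₃ 12) , tt)
      y-zero-or-suc-in-w′ : ⊢ Γy ⇒ₛ ZeroOrSuc 10 1
      y-zero-or-suc-in-w′ =
        tautology! (Γy ∷ var 1 ≐ ∅ₛ ∷ SucOfElem 6 1 ∷ SucOfElem 10 1 ∷ [])
          ((0 ⟹ 1 ∣∣ 2) ∷ (0 ⟹ 2 ⟹ 1 ∣∣ 3) ∷ []) (0 ⟹ 1 ∣∣ 3) (y-zero-or-suc-in-v , y-suc-case , tt)

    w∈C∧w∈HF : ⊢ Γₛ ⇒ₛ (10 ∈ᵛ 9 ∧ₛ var 10 ∈ₛ HF)
    w∈C∧w∈HF =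
      tautology! (Γₛ ∷ 10 ∈ᵛ 6 ∷ var 10 ∈ₛ HF ∷ 10 ∈ᵛ 10 ∷ No2Cycle 10 ∷ N[ 10 ] ∷ 10 ∈ᵛ 9 ∷ var 6 ≐ suc₃ 10 ∷ [])
        ((0 ⟹ 1 ⟹ 2 & ~ 3 & 4 & (5 ⟹ 6)) ∷ (0 ⟹ 1 & 7) ∷ (0 ⟹ 5) ∷ []) (0 ⟹ 6 & 2)
        (w-tame , v≡Sw , N-pred , tt)

    v∈C : ⊢ Γₛ ⇒ₛ 6 ∈ᵛ 9
    v∈C = tautology! (Γₛ ∷ 10 ∈ᵛ 9 ∷ var 10 ∈ₛ HF ∷ suc₃ 10 ∈ₛ var 9 ∷ suc₃ 10 ≐ var 6 ∷ 6 ∈ᵛ 9 ∷ var 6 ≐ suc₃ 10 ∷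
                      10 ∈ᵛ 6 ∷ [])
            ((0 ⟹ 1 & 2 ⟹ 3) ∷ (0 ⟹ 1 & 2) ∷ (4 ⟹ 3 ⟹ 5) ∷ (6 ⟹ 4) ∷ (0 ⟹ 7 & 6) ∷ []) (0 ⟹ 5)
            (∀-elim-under! sucClosed (var 10) , w∈C∧w∈HF , eq-subst! 12 (var 12 ∈ₛ var 9) (suc₃ 10) (var 6) ,
             Sw≐v , v≡Sw , tt)
      where
      sucClosed : ⊢ Γₛ ⇒ₛ ∀ₛ 5 ((5 ∈ᵛ 9 ∧ₛ var 5 ∈ₛ HF) ⇒ₛ suc₃ 5 ∈ₛ var 9)
      sucClosed = tautology! (∅ₛ ∈ₛ var 9 ∷ ∀ₛ 5 ((5 ∈ᵛ 9 ∧ₛ var 5 ∈ₛ HF) ⇒ₛ suc₃ 5 ∈ₛ var 9) ∷ var 6 ∈ₛ Tames ∷ N[ 6 ] ∷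
                              (10 ∈ᵛ 6 ∧ₛ var 6 ≐ suc₃ 10) ∷ [])
                    [] ((((0 & 1) & 2) & 3) & 4 ⟹ 1) tt

  ΓN : Formula
  ΓN = Γ ∧ₛ N[ 6 ]

  N⇒∈C : ⊢ ΓN ⇒ₛ 6 ∈ᵛ 9
  N⇒∈C = tautology! (ΓN ∷ var 6 ≐ ∅ₛ ∷ SucOfElem 6 6 ∷ 6 ∈ᵛ 9 ∷ [])
           ((0 ⟹ 1 ∣∣ 2) ∷ (0 ⟹ 1 ⟹ 3) ∷ (0 ⟹ 2 ⟹ 3) ∷ []) (0 ⟹ 3)
           (zero-or-suc , zero-case , suc-case , tt)
    where
    zero-or-suc : ⊢ ΓN ⇒ₛ ZeroOrSuc 6 6
    zero-or-suc =
      tautology! (ΓN ∷ var 6 ∈ₛ suc₁ 6 ∷ ZeroOrSuc 6 6 ∷ 6 ∈ᵛ 6 ∷ 6 ≐ᵛ 6 ∷ [])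
        ((0 ⟹ 1 ⟹ 2) ∷ (1 ⟺ 3 ∣∣ 4) ∷ 4 ∷ []) (0 ⟹ 2)
        (∀∈-elim-under! 1 (suc₁ 6) (ZeroOrSuc 6 1) 6 (∧-assumption wfF! wfF!) ,
         ∈-adjoin (fresh-binders (λ ()) (λ ()) (inj₁ refl)) 6 , eq-refl 6 , tt)
    zero-case : ⊢ ΓN ⇒ₛ (var 6 ≐ ∅ₛ ⇒ₛ 6 ∈ᵛ 9)
    zero-case =
      tautology! (∅ₛ ∈ₛ var 9 ∷ ∀ₛ 5 ((5 ∈ᵛ 9 ∧ₛ var 5 ∈ₛ HF) ⇒ₛ suc₃ 5 ∈ₛ var 9) ∷ var 6 ∈ₛ Tames ∷ N[ 6 ] ∷
                  var 6 ≐ ∅ₛ ∷ ∅ₛ ≐ var 6 ∷ 6 ∈ᵛ 9 ∷ [])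
        ((5 ⟹ 0 ⟹ 6) ∷ (4 ⟹ 5) ∷ []) (((0 & 1) & 2) & 3 ⟹ 4 ⟹ 6)
        (eq-subst! 12 (var 12 ∈ₛ var 9) ∅ₛ (var 6) , ≐-sym! (var 6) ∅ₛ , tt)
    suc-case : ⊢ ΓN ⇒ₛ (SucOfElem 6 6 ⇒ₛ 6 ∈ᵛ 9)
    suc-case =
      tautology! (ΓN ∷ SucOfElem 6 6 ∷ ∃ₛ 10 (10 ∈ᵛ 6 ∧ₛ var 6 ≐ suc₃ 10) ∷ 6 ∈ᵛ 9 ∷ [])
        ((0 ⟹ 2 ⟹ 3) ∷ (1 ⟹ 2) ∷ []) (0 ⟹ 1 ⟹ 3)
        (∃-elim-under 10 (⇒-curry SucCase.v∈C) ∉! ∉! , ∃-rename! 2 10 (10 ∈ᵛ 6 ∧ₛ var 6 ≐ suc₃ 10) , tt)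

  tame : ⊢ Γ ⇒ₛ Tame 6
  tame = tautology! (Γ ∷ var 6 ∈ₛ HF ∷ 6 ∈ᵛ 6 ∷ No2Cycle 6 ∷ (N[ 6 ] ⇒ₛ 6 ∈ᵛ 9) ∷ [])
           ((0 ⟹ 1) ∷ (0 ⟹ ~ 2) ∷ (0 ⟹ 3) ∷ (0 ⟹ 4) ∷ []) (0 ⟹ 1 & ~ 2 & 3 & 4)
           (inHF , ∉self , no2Cycle , ⇒-curry N⇒∈C , tt)

Tames⊆Tame : ⊢ SucClosed ⇒ₛ ∀ₛ 6 (var 6 ∈ₛ Tames ⇒ₛ Tame 6)
Tames⊆Tame = ∀-intro-under 6 (⇒-curry TameMembers.tame) ∉!

adjoin₂ : ℕ → ℕ → Term
adjoin₂ a b = adjoin 2 2 (var a) (var b)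

adjoin₃ : ℕ → ℕ → Term
adjoin₃ a b = adjoin 3 3 (var a) (var b)

module AdjoinClosed where

  Γ : Formula
  Γ = SucClosed ∧ₛ (var 10 ∈ₛ Tames ∧ₛ var 11 ∈ₛ Tames)

  HFAllTame₁₀ : ⊢ Γ ⇒ₛ HFAllTame 10
  HFAllTame₁₀ = tautology! (Γ ∷ var 10 ∈ₛ Tames ∷ var 11 ∈ₛ Tames ∷ HFAllTame 10 ∷ [])
                  ((1 ⟺ 3) ∷ (0 ⟹ 1 & 2) ∷ []) (0 ⟹ 3) (∈Tames⇔ 10 , ∧-assumption wfF! wfF! , tt)

  HFAllTame₁₁ : ⊢ Γ ⇒ₛ HFAllTame 11
  HFAllTame₁₁ = tautology! (Γ ∷ var 10 ∈ₛ Tames ∷ var 11 ∈ₛ Tames ∷ HFAllTame 11 ∷ [])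
                  ((2 ⟺ 3) ∷ (0 ⟹ 1 & 2) ∷ []) (0 ⟹ 3) (∈Tames⇔ 11 , ∧-assumption wfF! wfF! , tt)

  -- hf-closed is stated with the bound variable 2; extensionality moves it to 3.
  adjoin₂≐adjoin₃ : ⊢ adjoin₂ 10 11 ≐ adjoin₃ 10 11
  adjoin₂≐adjoin₃ = adjoin-≐ (fresh-binders (λ ()) (λ ()) (inj₁ refl)) (fresh-binders (λ ()) (λ ()) (inj₁ refl))
                      λ { _ (here refl) → ∉! ; _ (there (here refl)) → ∉! }

  adjoin∈HF : ⊢ Γ ⇒ₛ adjoin₃ 10 11 ∈ₛ HF
  adjoin∈HF =
    tautology! (Γ ∷ var 10 ∈ₛ HF ∷ AllTame 10 ∷ var 11 ∈ₛ HF ∷ AllTame 11 ∷ adjoin₂ 10 11 ∈ₛ HF ∷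
                adjoin₂ 10 11 ≐ adjoin₃ 10 11 ∷ adjoin₃ 10 11 ∈ₛ HF ∷ [])
      ((0 ⟹ 1 & 2) ∷ (0 ⟹ 3 & 4) ∷ (1 & 3 ⟹ 5) ∷ 6 ∷ (6 ⟹ 5 ⟹ 7) ∷ []) (0 ⟹ 7)
      (HFAllTame₁₀ , HFAllTame₁₁ , ∀-elim! (∀-elim! (ax hf-closed) (var 10)) (var 11) , adjoin₂≐adjoin₃ ,
       eq-subst! 12 (var 12 ∈ₛ HF) (adjoin₂ 10 11) (adjoin₃ 10 11) , tt)

  adjoin-AllTame : ⊢ Γ ⇒ₛ ∀∈ 7 (adjoin₃ 10 11) (Tame 7)
  adjoin-AllTame =
    ¬∃-intro-under 7
      (tautology! (Γ ∷ var 7 ∈ₛ adjoin₃ 10 11 ∷ 7 ∈ᵛ 10 ∷ 7 ≐ᵛ 11 ∷ Tame 7 ∷ var 11 ∈ₛ Tames ∷ Tame 11 ∷ 11 ≐ᵛ 7 ∷ [])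
         ((1 ⟺ 2 ∣∣ 3) ∷ (0 ⟹ 2 ⟹ 4) ∷ (0 ⟹ 5 ⟹ 6) ∷ (0 ⟹ 5) ∷ (7 ⟹ 6 ⟹ 4) ∷ (3 ⟹ 7) ∷ []) (0 ⟹ ~ (1 & ~ 4))
         (∈-adjoin (fresh-binders (λ ()) (λ ()) (inj₁ refl)) 7 ,
          ∀∈-elim-under! 7 (var 10) (Tame 7) 7
            (tautology! (Γ ∷ var 10 ∈ₛ HF ∷ AllTame 10 ∷ []) ((0 ⟹ 1 & 2) ∷ []) (0 ⟹ 2) (HFAllTame₁₀ , tt)) ,
          ∀-elim-under! (⇒-trans (tautology! (SucClosed ∷ (var 10 ∈ₛ Tames ∧ₛ var 11 ∈ₛ Tames) ∷ []) [] (0 & 1 ⟹ 0) tt)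
                                  Tames⊆Tame) (var 11) ,
          tautology! (SucClosed ∷ var 10 ∈ₛ Tames ∷ var 11 ∈ₛ Tames ∷ []) [] (0 & 1 & 2 ⟹ 2) tt ,
          eq-subst! 12 (Tame 12) (var 11) (var 7) , ≐-sym! (var 7) (var 11) , tt))
      ∉!

  adjoin∈Tames : ⊢ Γ ⇒ₛ adjoin₃ 10 11 ∈ₛ Tames
  adjoin∈Tames =
    tautology! (Γ ∷ adjoin₃ 10 11 ∈ₛ Tames ∷ adjoin₃ 10 11 ∈ₛ HF ∷ ∀∈ 7 (adjoin₃ 10 11) (Tame 7) ∷ [])
      ((1 ⟺ 2 & 3) ∷ (0 ⟹ 2) ∷ (0 ⟹ 3) ∷ []) (0 ⟹ 1)
      (comprehension! 4 (HFAllTame 4) (adjoin₃ 10 11) , adjoin∈HF , adjoin-AllTame , tt)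

Tames-adjoin-closed : ⊢ SucClosed ⇒ₛ ∀∈ 1 Tames (∀∈ 2 Tames (adjoin₃ 1 2 ∈ₛ Tames))
Tames-adjoin-closed =
  ¬∃-intro-under 1
    (tautology! (SucClosed ∷ var 1 ∈ₛ Tames ∷ ∀∈ 2 Tames (adjoin₃ 1 2 ∈ₛ Tames) ∷ [])
       ((0 & 1 ⟹ 2) ∷ []) (0 ⟹ ~ (1 & ~ 2)) (inner , tt)) ∉!
  where
  closed₁₂ : ⊢ SucClosed ⇒ₛ ((var 1 ∈ₛ Tames ∧ₛ var 2 ∈ₛ Tames) ⇒ₛ adjoin₃ 1 2 ∈ₛ Tames)
  closed₁₂ = ∀-elim-under! (∀-elim-under! closed (var 1)) (var 2)
    where
    closed : ⊢ SucClosed ⇒ₛ ∀ₛ 10 (∀ₛ 11 ((var 10 ∈ₛ Tames ∧ₛ var 11 ∈ₛ Tames) ⇒ₛ adjoin₃ 10 11 ∈ₛ Tames))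
    closed = ∀-intro-under 10 (∀-intro-under 11 (⇒-curry AdjoinClosed.adjoin∈Tames) ∉!) ∉!
  inner : ⊢ SucClosed ∧ₛ var 1 ∈ₛ Tames ⇒ₛ ∀∈ 2 Tames (adjoin₃ 1 2 ∈ₛ Tames)
  inner = ¬∃-intro-under 2
            (tautology! (SucClosed ∷ var 1 ∈ₛ Tames ∷ var 2 ∈ₛ Tames ∷ adjoin₃ 1 2 ∈ₛ Tames ∷ [])
               ((0 ⟹ 1 & 2 ⟹ 3) ∷ []) (0 & 1 ⟹ ~ (2 & ~ 3)) (closed₁₂ , tt)) ∉!

∅∈Tames : ⊢ ∅ₛ ∈ₛ Tames
∅∈Tames =
  tautology! (∅ₛ ∈ₛ Tames ∷ ∅ₛ ∈ₛ HF ∷ ∀∈ 7 ∅ₛ (Tame 7) ∷ []) ((0 ⟺ 1 & 2) ∷ 1 ∷ 2 ∷ []) 0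
    (comprehension! 4 (HFAllTame 4) ∅ₛ , ax hf-empty , ∅-AllTame , tt)
  where
  ∅-AllTame : ⊢ ∀∈ 7 ∅ₛ (Tame 7)
  ∅-AllTame = ¬∃-intro 7 (tautology! (var 7 ∈ₛ ∅ₛ ∷ 7 ≐ᵛ 7 ∷ Tame 7 ∷ []) ((0 ⟺ ~ 1) ∷ 1 ∷ []) (~ (0 & ~ 2))
                            (comprehension! 0 (¬ₛ (0 ≐ᵛ 0)) (var 7) , eq-refl 7 , tt))

HF⊆Tames : ⊢ SucClosed ⇒ₛ ∀ₛ 3 (var 3 ∈ₛ HF ⇒ₛ var 3 ∈ₛ Tames)
HF⊆Tames = mp-under (∧-intro-under (weaken wfF! ∅∈Tames) Tames-adjoin-closed) (weaken wfF! (∀-elim! (ax hf-least) Tames))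

Ñ⊆C : ⊢ SucClosed ⇒ₛ ∀∈ 5 Ñ (5 ∈ᵛ 9)
Ñ⊆C =
  ¬∃-intro-under 5
    (tautology! (SucClosed ∷ var 5 ∈ₛ Ñ ∷ var 5 ∈ₛ HF ∷ N[ 5 ] ∷ var 5 ∈ₛ Tames ∷ 5 ∈ᵛ 5 ∷ No2Cycle 5 ∷ 5 ∈ᵛ 9 ∷ [])
       ((1 ⟺ 2 & 3) ∷ (0 ⟹ 2 ⟹ 4) ∷ (0 ⟹ 4 ⟹ 2 & ~ 5 & 6 & (3 ⟹ 7)) ∷ []) (0 ⟹ ~ (1 & ~ 7))
       (comprehension! 0 (var 0 ∈ₛ HF ∧ₛ N[ 0 ]) (var 5) , ∀-elim-under! HF⊆Tames (var 5) ,
        ∀-elim-under! Tames⊆Tame (var 5) , tt))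
    ∉!

-- Induction along Ñ

module Induction (φ : Formula) (x : ℕ) (φ-safe : φ ≻ []) where

  wφ : WfF φ
  wφ = safe⇒wf φ-safe

  A : Term
  A = abs x (var x ∈ₛ HF ∧ₛ φ)

  A-wf : WfT A
  A-wf = wf-abs (≻-∧ (≻-x∈t wf-HF λ ()) φ-safe (inj₁ λ _ ()))

  ∈A⇔ : ∀ {t} → WfT t → FreeForF x t φ → ⊢ t ∈ₛ A ⇔ₛ (t ∈ₛ HF ∧ₛ subF x t φ)
  ∈A⇔ {t} wt ff = subst (λ s → ⊢ t ∈ₛ A ⇔ₛ (s ∈ₛ HF ∧ₛ subF x t φ)) (subT-var-self x t)
                    (comprehension-inst A-wf wt ((tt , tt) , ff))

  z₁ z₂ : ℕ
  z₁ = fresh (x ∷ fvT (sing (var x)))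
  z₂ = fresh (x ∷ [])

  z₁≢x : z₁ ≢ x
  z₁≢x e = fresh-∉ (x ∷ fvT (sing (var x))) (here e)

  z₂≢x : z₂ ≢ x
  z₂≢x e = fresh-∉ (x ∷ []) (here e)

  Sx-wf : WfT (Sₛ (var x))
  Sx-wf = adjoin-wf (fresh-binders z₁≢x z₂≢x (inj₂ z₁≢x))

  avoided : List ℕ
  avoided = x ∷ z₁ ∷ z₂ ∷ fvF φ ++ bvF φ

  -- Being at least 10, y differs from all the variables written as numerals
  -- above, and those inequalities are decided by computation.
  y : ℕ
  y = 10 + fresh avoided

  avoided≢y : ∀ {v} → v ∈ avoided → v ≢ y
  avoided≢y v∈ = <⇒≢ (≤-trans (s≤s (≤-foldr-⊔ v∈)) (m≤n+m (suc (foldr _⊔_ 0 avoided)) 10))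

  x≢y : x ≢ y
  x≢y = avoided≢y (here refl)

  z₁≢y : z₁ ≢ y
  z₁≢y = avoided≢y (there (here refl))

  z₂≢y : z₂ ≢ y
  z₂≢y = avoided≢y (there (there (here refl)))

  y∉fvφ : y ∉ fvF φ
  y∉fvφ p = avoided≢y (there (there (there (∈-++⁺ˡ p)))) refl

  y∉bvφ : y ∉ bvF φ
  y∉bvφ p = avoided≢y (there (there (there (∈-++⁺ʳ (fvF φ) p)))) refl

  y∉A : y ∉ fvT A
  y∉A p with proj₁ (∈-remove⁻ (fvF (var x ∈ₛ HF ∧ₛ φ)) p)
  ... | here e = x≢y (sym e)
  ... | there q = y∉fvφ q

  Sy : Term
  Sy = adjoin z₁ z₂ (var y) (var y)

  Sy-wf : WfT Sy
  Sy-wf = adjoin-wf (fresh-binders z₁≢y z₂≢y (inj₂ z₁≢y))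

  φ₀ φS φy φSy : Formula
  φ₀ = subF x zeroₛ φ
  φS = subF x (Sₛ (var x)) φ
  φy = subF x (var y) φ
  φSy = subF x Sy φ

  ff₀ : FreeForF x zeroₛ φ
  ff₀ = freeForF-bv x zeroₛ φ λ _ ()

  ffS : FreeForF x (Sₛ (var x)) φ
  ffS = freeForF-fv⊆x x (Sₛ (var x)) φ λ _ → fv-adjoin-diag z₁ z₂ x

  ffy : FreeForF x (var y) φ
  ffy = freeForF-bv x (var y) φ λ { _ (here refl) → y∉bvφ }

  ffSy : FreeForF x Sy φ
  ffSy = freeForF-bv x Sy φ λ _ w∈ → subst (_∉ bvF φ) (sym (fv-adjoin-diag z₁ z₂ y w∈)) y∉bvφ

  φ₀-wf : WfF φ₀
  φ₀-wf = subF-wf φ wfT! ff₀ wφ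

  φS-wf : WfF φS
  φS-wf = subF-wf φ Sx-wf ffS wφ

  φy-wf : WfF φy
  φy-wf = subF-wf φ (wf-var y) ffy wφ

  φSy-wf : WfF φSy
  φSy-wf = subF-wf φ Sy-wf ffSy wφ

  Step : Formula
  Step = ∀ₛ x (φ ⇒ₛ φS)

  Step-wf : WfF Step
  Step-wf = wf-¬ (wf-∃ x (wf-¬ (wf-∨ (wf-¬ wφ) φS-wf)))

  H : Formula
  H = φ₀ ∧ₛ Step

  H-wf : WfF H
  H-wf = wf-∧ φ₀-wf Step-wf

  y∉H : y ∉ fvF H
  y∉H = ∉-++ (∉-fvF-subF x zeroₛ φ y∉fvφ λ ())
             (λ p → ∉-++ y∉fvφ (∉-fvF-subF x (Sₛ (var x)) φ y∉fvφ (x≢y ∘ sym ∘ fv-adjoin-diag z₁ z₂ x))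
                            (proj₁ (∈-remove⁻ (fvF φ ++ fvF φS) p)))

  ∅∈A : ⊢ H ⇒ₛ ∅ₛ ∈ₛ A
  ∅∈A = tautology (φ₀ ∷ Step ∷ ∅ₛ ∈ₛ A ∷ ∅ₛ ∈ₛ HF ∷ []) ((2 ⟺ 3 & 0) ∷ 3 ∷ []) (0 & 1 ⟹ 2)
          (φ₀-wf ∷ Step-wf ∷ wf-∈ wfT! A-wf ∷ wfF! ∷ [])
          (∈A⇔ wfT! ff₀ , ax hf-empty , tt)

  step-at-y : ⊢ Step ⇒ₛ (φy ⇒ₛ φSy)
  step-at-y = subst (λ ψ → ⊢ Step ⇒ₛ (φy ⇒ₛ ψ)) S[x]≡Sy
                (∀-elim x (var y) (wf-∨ (wf-¬ wφ) φS-wf) (wf-var y) (ffy , ffyS))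
    where
    S[x]≡Sy : subF x (var y) φS ≡ φSy
    S[x]≡Sy = trans (subF-subF x (var y) (Sₛ (var x)) φ)
                    (cong (λ t → subF x t φ) (subT-adjoin z₁ z₂ x (var y) z₁≢x z₂≢x))
    ffyS : FreeForF x (var y) φS
    ffyS = freeForF-bv x (var y) φS λ { _ (here refl) p → y∉bvS (∈-bvF-subF x (Sₛ (var x)) φ p) }
      where
      y∉bvS : y ∈ bvF φ ⊎ y ∈ z₁ ∷ z₂ ∷ [] → ⊥
      y∉bvS (inj₁ q) = y∉bvφ q
      y∉bvS (inj₂ (here e)) = z₁≢y (sym e)
      y∉bvS (inj₂ (there (here e))) = z₂≢y (sym e)

  adjoin-y-≐Sy : ∀ {b₁ b₂} → FreshBinders b₁ b₂ y y → ⊢ adjoin b₁ b₂ (var y) (var y) ≐ Sy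
  adjoin-y-≐Sy ok = adjoin-≐ ok (fresh-binders z₁≢y z₂≢y (inj₂ z₁≢y)) λ { _ (here refl) → ∉! ; _ (there (here refl)) → ∉! }

  Γy : Formula
  Γy = H ∧ₛ (var y ∈ₛ A ∧ₛ var y ∈ₛ HF)

  Sy∈A : ⊢ Γy ⇒ₛ Sy ∈ₛ A
  Sy∈A =
    tautology (φ₀ ∷ Step ∷ var y ∈ₛ A ∷ var y ∈ₛ HF ∷ φy ∷ φSy ∷ adjoin 2 2 (var y) (var y) ∈ₛ HF ∷
               adjoin 2 2 (var y) (var y) ≐ Sy ∷ Sy ∈ₛ HF ∷ Sy ∈ₛ A ∷ [])
      ((2 ⟺ 3 & 4) ∷ (1 ⟹ 4 ⟹ 5) ∷ (3 & 3 ⟹ 6) ∷ 7 ∷ (7 ⟹ 6 ⟹ 8) ∷ (9 ⟺ 8 & 5) ∷ []) ((0 & 1) & (2 & 3) ⟹ 9)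
      (φ₀-wf ∷ Step-wf ∷ wf-∈ (wf-var y) A-wf ∷ wf-∈ (wf-var y) wf-HF ∷ φy-wf ∷ φSy-wf ∷ wf-∈ wfT! wf-HF ∷
       wf-≐ wfT! Sy-wf ∷ wf-∈ Sy-wf wf-HF ∷ wf-∈ Sy-wf A-wf ∷ [])
      (∈A⇔ (wf-var y) ffy , step-at-y , ∀-elim! (∀-elim! (ax hf-closed) (var y)) (var y) ,
       adjoin-y-≐Sy (fresh-binders (λ ()) (λ ()) (inj₁ refl)) , ≐-subst-∈ wfT! Sy-wf wf-HF , ∈A⇔ Sy-wf ffSy , tt)

  A-suc-closed : ⊢ H ⇒ₛ ∀ₛ y ((var y ∈ₛ A ∧ₛ var y ∈ₛ HF) ⇒ₛ suc₃ y ∈ₛ A)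
  A-suc-closed = ∀-intro-under y (⇒-curry suc₃y∈A) y∉H
    where
    suc₃y∈A : ⊢ Γy ⇒ₛ suc₃ y ∈ₛ A
    suc₃y∈A =
      tautology (Γy ∷ Sy ∈ₛ A ∷ suc₃ y ≐ Sy ∷ Sy ≐ suc₃ y ∷ suc₃ y ∈ₛ A ∷ [])
        ((0 ⟹ 1) ∷ 2 ∷ (2 ⟹ 3) ∷ (3 ⟹ 1 ⟹ 4) ∷ []) (0 ⟹ 4)
        (wf-∧ H-wf (wf-∧ (wf-∈ (wf-var y) A-wf) (wf-∈ (wf-var y) wf-HF)) ∷ wf-∈ Sy-wf A-wf ∷ wf-≐ wfT! Sy-wf ∷
         wf-≐ Sy-wf wfT! ∷ wf-∈ wfT! A-wf ∷ [])
        (Sy∈A , adjoin-y-≐Sy (fresh-binders (λ ()) (λ ()) (inj₁ refl)) , ≐-sym wfT! Sy-wf , ≐-subst-∈ Sy-wf wfT! A-wf , tt)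

  SucClosedAt : ℕ → Formula
  SucClosedAt v = (v ∈ᵛ 9 ∧ₛ var v ∈ₛ HF) ⇒ₛ suc₃ v ∈ₛ var 9

  -- Ñ⊆C quantifies over the variable 5, which φ (hence A) may mention; renaming
  -- it to the fresh y makes the instantiation C := A capture-free.
  Ñ⊆C-at-y : ⊢ (∅ₛ ∈ₛ var 9 ∧ₛ ∀ₛ y (SucClosedAt y)) ⇒ₛ ∀∈ y Ñ (y ∈ᵛ 9)
  Ñ⊆C-at-y = ⇒-trans (⇒-trans rename-hypothesis Ñ⊆C) rename-conclusion
    where
    S[5/y] : subF y (var 5) (SucClosedAt y) ≡ SucClosedAt 5
    S[5/y] = cong (λ a → (a ∈ₛ var 9 ∧ₛ a ∈ₛ HF) ⇒ₛ adjoin 3 3 a a ∈ₛ var 9) (subT-var-self y (var 5))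
    ∀y⇒∀5 : ⊢ ∀ₛ y (SucClosedAt y) ⇒ₛ ∀ₛ 5 (SucClosedAt 5)
    ∀y⇒∀5 = subst (λ ψ → ⊢ ∀ₛ y (SucClosedAt y) ⇒ₛ ¬ₛ (∃ₛ 5 (¬ₛ ψ))) S[5/y]
              (¬∃-rename 5 y (¬ₛ (SucClosedAt y)) wfF! (freeForF-bv y (var 5) (¬ₛ (SucClosedAt y)) λ { _ (here refl) → ∉! })
                 (λ p → ∉! {5} {fvF (¬ₛ (SucClosedAt y))} (proj₁ (∈-remove⁻ {y = y} (fvF (¬ₛ (SucClosedAt y))) p))))
    rename-hypothesis : ⊢ (∅ₛ ∈ₛ var 9 ∧ₛ ∀ₛ y (SucClosedAt y)) ⇒ₛ SucClosed
    rename-hypothesis =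
      tautology (∅ₛ ∈ₛ var 9 ∷ ∀ₛ y (SucClosedAt y) ∷ ∀ₛ 5 (SucClosedAt 5) ∷ []) ((1 ⟹ 2) ∷ []) (0 & 1 ⟹ 0 & 2)
        (wfF! ∷ ⇒-wfˡ ∀y⇒∀5 ∷ ⇒-wfʳ ∀y⇒∀5 ∷ []) (∀y⇒∀5 , tt)
    rename-conclusion : ⊢ ∀∈ 5 Ñ (5 ∈ᵛ 9) ⇒ₛ ∀∈ y Ñ (y ∈ᵛ 9)
    rename-conclusion = ¬∃-rename y 5 (var 5 ∈ₛ Ñ ∧ₛ ¬ₛ (5 ∈ᵛ 9)) wfF! (freeForF! {5} {var y} {var 5 ∈ₛ Ñ ∧ₛ ¬ₛ (5 ∈ᵛ 9)}) ∉!

  Ñ⊆A-at-y : ⊢ H ⇒ₛ ∀∈ y Ñ (var y ∈ₛ A)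
  Ñ⊆A-at-y = ⇒-trans (∧-intro-under ∅∈A A-suc-closed) (mp (∀-intro 9 Ñ⊆C-at-y) (∀-elim 9 A (⊢-wf Ñ⊆C-at-y) A-wf ff))
    where
    ff = ((inj₁ (λ ()) , tt) , inj₂ (y∉A , (((tt , tt) , (tt , tt)) , (inj₁ ∉! , tt)))) ,
         inj₂ (y∉A , ((tt , inj₁ (λ ())) , (tt , tt)))

  Ñ⊆A : ⊢ H ⇒ₛ ∀∈ x Ñ φ
  Ñ⊆A = tautology (H ∷ ∃ₛ x (var x ∈ₛ Ñ ∧ₛ ¬ₛ φ) ∷ ∃ₛ y (var y ∈ₛ Ñ ∧ₛ ¬ₛ (var y ∈ₛ A)) ∷ [])
          ((0 ⟹ ~ 2) ∷ (1 ⟹ 2) ∷ []) (0 ⟹ ~ 1) (H-wf ∷ ⇒-wfˡ x-witness⇒y-witness ∷ ⇒-wfʳ x-witness⇒y-witness ∷ [])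
          (Ñ⊆A-at-y , x-witness⇒y-witness , tt)
    where
    x∈A⇔ : ⊢ var x ∈ₛ A ⇔ₛ (var x ∈ₛ HF ∧ₛ φ)
    x∈A⇔ = subst (λ ψ → ⊢ var x ∈ₛ A ⇔ₛ (var x ∈ₛ HF ∧ₛ ψ)) (subF-self x φ)
             (∈A⇔ (wf-var x) (freeForF-fv⊆x x (var x) φ λ { _ (here e) → e }))
    ¬φ⇒x∉A : ⊢ (var x ∈ₛ Ñ ∧ₛ ¬ₛ φ) ⇒ₛ (var x ∈ₛ Ñ ∧ₛ ¬ₛ (var x ∈ₛ A))
    ¬φ⇒x∉A = tautology (var x ∈ₛ Ñ ∷ φ ∷ var x ∈ₛ A ∷ var x ∈ₛ HF ∷ []) ((2 ⟺ 3 & 1) ∷ []) (0 & ~ 1 ⟹ 0 & ~ 2)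
               (wf-∈ (wf-var x) wfT! ∷ wφ ∷ wf-∈ (wf-var x) A-wf ∷ wf-∈ (wf-var x) wf-HF ∷ []) (x∈A⇔ , tt)
    y-witness : ⊢ (var x ∈ₛ Ñ ∧ₛ ¬ₛ (var x ∈ₛ A)) ⇒ₛ ∃ₛ y (var y ∈ₛ Ñ ∧ₛ ¬ₛ (var y ∈ₛ A))
    y-witness = subst (λ ψ → ⊢ ψ ⇒ₛ ∃ₛ y (var y ∈ₛ Ñ ∧ₛ ¬ₛ (var y ∈ₛ A)))
                  (cong₂ (λ a B → a ∈ₛ Ñ ∧ₛ ¬ₛ (a ∈ₛ B)) (subT-var-self y (var x)) (subT-notFree y (var x) A y∉A))
                  (∃-ax y (wf-∧ (wf-∈ (wf-var y) wfT!) (wf-¬ (wf-∈ (wf-var y) A-wf))) (wf-var x)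
                     ((tt , inj₁ λ ()) , (tt , inj₁ y∉A)))
    x∉y-witness : x ∉ fvF (∃ₛ y (var y ∈ₛ Ñ ∧ₛ ¬ₛ (var y ∈ₛ A)))
    x∉y-witness p with ∈-remove⁻ (y ∷ y ∷ fvT A) p
    ... | here e , x≢y = x≢y e
    ... | there (here e) , x≢y = x≢y e
    ... | there (there q) , _ = ∉-remove (fvF (var x ∈ₛ HF ∧ₛ φ)) q
    x-witness⇒y-witness : ⊢ ∃ₛ x (var x ∈ₛ Ñ ∧ₛ ¬ₛ φ) ⇒ₛ ∃ₛ y (var y ∈ₛ Ñ ∧ₛ ¬ₛ (var y ∈ₛ A))
    x-witness⇒y-witness = ∃-intro x (⇒-trans ¬φ⇒x∉A y-witness) x∉y-witness

proposition4p4 : (φ : Formula) (x : ℕ) → φ ≻ [] →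
    RST⊢ ((subF x zeroₛ φ ∧ₛ ∀ₛ x (φ ⇒ₛ subF x (Sₛ (var x)) φ)) ⇒ₛ ∀∈ x Ñ φ)
proposition4p4 φ x φ-safe = Induction.Ñ⊆A φ x φ-safe
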